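{- For integers $n\ge1$ and $k\ge0$, let $f_{\mathrm{UFR}}(n,k)$ be the number of unit Fubini rankings with $n$ competitors having exactly $k$ lucky cars. Then $f_{\mathrm{UFR}}(n,k)=k!\,S_{\le2}(n,k)$, where $S_{\le2}(n,k)$ is the number of (unordered) set partitions of $[n]$ into $k$ nonempty blocks each of size at most $2$.
   Context: A Fubini ranking with $n$ competitors is a tuple $\alpha=(a_1,\ldots,a_n)\in[n]^n$ with $a_i=1+|\{j:a_j<a_i\}|$ for every $i$. A unit Fubini ranking is a Fubini ranking in which each value appears at most twice. Lucky cars: cars $1,\ldots,n$ enter in order a one-way street with spots $1,\ldots,n$; car $i$ parks at spot $a_i$ if free, else at the first free spot after $a_i$; car $i$ is lucky if it parks at spot $a_i$. -}

module Defs where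

open import Data.Bool using (Bool; true; false; if_then_else_; not; _∧_; _∨_)
open import Data.Nat using (ℕ; zero; suc; _+_; _≡ᵇ_; _<ᵇ_; _≤ᵇ_)
open import Data.List using (List; []; _∷_; length; map; concatMap; filterᵇ; upTo; allFin; lookup; applyUpTo)
open import Data.Fin using (Fin; toℕ)
open import Data.Bool.ListAction using (all; any)

tuplesOver : {A : Set} → List A → ℕ → List (List A)
tuplesOver xs zero    = [] ∷ []
tuplesOver xs (suc m) = concatMap (λ x → map (x ∷_) (tuplesOver xs m)) xs

countᵇ : {A : Set} → (A → Bool) → List A → ℕ
countᵇ p xs = length (filterᵇ p xs)

range1 : ℕ → List ℕ
range1 n = applyUpTo suc n

allTuples : ℕ → List (List ℕ)
allTuples n = tuplesOver (range1 n) n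

isFubiniᵇ : List ℕ → Bool
isFubiniᵇ α = all (λ a → a ≡ᵇ suc (countᵇ (λ b → b <ᵇ a) α)) α

atMostTwiceᵇ : List ℕ → Bool
atMostTwiceᵇ α = all (λ v → countᵇ (λ b → b ≡ᵇ v) α ≤ᵇ 2) α

isUnitFubiniᵇ : List ℕ → Bool
isUnitFubiniᵇ α = isFubiniᵇ α ∧ atMostTwiceᵇ α

occupiedᵇ : List ℕ → ℕ → Bool
occupiedᵇ occ s = any (λ t → t ≡ᵇ s) occ

-- first spot ≥ s not in occ (fuel = |occ|+1 always suffices)
firstFreeFrom : ℕ → List ℕ → ℕ → ℕ
firstFreeFrom zero       occ s = s
firstFreeFrom (suc fuel) occ s =
  if occupiedᵇ occ s then firstFreeFrom fuel occ (suc s) else s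

parkSpot : List ℕ → ℕ → ℕ
parkSpot occ a = firstFreeFrom (suc (length occ)) occ a

-- cars enter in order; occ = spots already taken; counts cars i with
-- car i parking at its preferred spot a_i (i.e. a_i free on arrival)
luckyFrom : List ℕ → List ℕ → ℕ
luckyFrom occ []       = 0
luckyFrom occ (a ∷ as) =
  (if occupiedᵇ occ a then 0 else 1) + luckyFrom (parkSpot occ a ∷ occ) as

luckyCount : List ℕ → ℕ
luckyCount α = luckyFrom [] α

fUFR : ℕ → ℕ → ℕ
fUFR n k = countᵇ (λ α → isUnitFubiniᵇ α ∧ (luckyCount α ≡ᵇ k)) (allTuples n)

-- a subset of [n] = {0,…,n-1} as its characteristic list of length n
allSubsets : ℕ → List (List Bool)
allSubsets n = tuplesOver (false ∷ true ∷ []) n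

card : List Bool → ℕ
card B = countᵇ (λ b → b) B

-- index of least element (only meaningful for nonempty blocks)
minElem : List Bool → ℕ
minElem []          = 0
minElem (true ∷ _)  = 0
minElem (false ∷ B) = suc (minElem B)

memᵇ : List Bool → ℕ → Bool
memᵇ []      _       = false
memᵇ (b ∷ _) zero    = b
memᵇ (_ ∷ B) (suc i) = memᵇ B i

coverCount : List (List Bool) → ℕ → ℕ
coverCount P i = countᵇ (λ B → memᵇ B i) P

-- blocks listed with strictly increasing least elements
-- (canonical listing of an unordered family of disjoint nonempty blocks)
sortedByMinᵇ : List (List Bool) → Bool
sortedByMinᵇ []           = true
sortedByMinᵇ (B ∷ [])     = true
sortedByMinᵇ (B ∷ C ∷ P)  = (minElem B <ᵇ minElem C) ∧ sortedByMinᵇ (C ∷ P)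

isPartition≤2ᵇ : ℕ → List (List Bool) → Bool
isPartition≤2ᵇ n P =
  all (λ B → (1 ≤ᵇ card B) ∧ (card B ≤ᵇ 2)) P
  ∧ all (λ i → coverCount P i ≡ᵇ 1) (upTo n)
  ∧ sortedByMinᵇ P

S≤2 : ℕ → ℕ → ℕ
S≤2 n k = countᵇ (isPartition≤2ᵇ n) (tuplesOver (allSubsets n) k)

module Submission where

-- A tuple α ∈ [n]^n is described by its profile: the number ν i of competitors ranked i + 1.
-- α is a unit Fubini ranking exactly when its profile is a sequence of blocks 1 (a competitor
-- alone) and 2 0 (a tie, which leaves the next rank unused). When such a ranking parks, every
-- car finds its preferred spot free unless it is the second car of a tie, which takes the free
-- spot after it; so the lucky cars are the first cars of the blocks, and k counts the blocks.
-- With a singletons and b ties (n = a + 2b, k = a + b) there are (a + b)! / (a! b!) profiles,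
-- each realised by n! / 2^b tuples, so f_UFR(n, k) = k! n! / (a! b! 2^b). Splitting off the
-- block of the least element gives S≤2(n + 1, k + 1) = S≤2(n, k) + n S≤2(n - 1, k), solved by
-- S≤2(n, k) = n! / (a! b! 2^b). Both counts are compared after multiplying by 2^b a! b!, and
-- both vanish when n and k admit no such a and b.

open import Defs
open import Data.Nat using (ℕ; _*_; _≤_; _!)
open import Relation.Binary.PropositionalEquality using (_≡_)

open import Algebra.Definitions (_≡_ {A = ℕ}) using (Associative; Commutative; LeftIdentity)
open import Data.Bool using (Bool; true; false; T; if_then_else_; not; _∧_; _∨_)
open import Data.Bool.ListAction using (all)
open import Data.Bool.Properties
  using (∧-commutativeMonoid; T-∧; T-∨; T-≡; ∨-assoc; ∨-zeroʳ; ∨-identityʳ; ∧-identityʳ; ∧-zeroʳ)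
open import Data.List using (List; []; _∷_; [_]; _++_; length; map; concatMap; applyUpTo; upTo)
open import Data.List.Properties using (length-map; length-++; ++-assoc; ++-identityʳ; filter-all; filter-none; filter-some)
open import Data.List.Relation.Unary.All as All using (All; []; _∷_)
open import Data.List.Relation.Unary.Any as Any using (here; there)
open import Data.List.Membership.Propositional using (_∈_)
open import Data.List.Relation.Unary.All.Properties using (++⁺; map⁺; concat⁺; applyUpTo⁺₁)
open import Data.Nat
open import Data.Nat.Properties
open import Algebra.Properties.CommutativeSemigroup +-commutativeSemigroup
  using () renaming (interchange to +-interchange)
open import Algebra.Properties.CommutativeSemigroup *-commutativeSemigroup using (x∙yz≈y∙xz; xy∙z≈xz∙y)
open import Algebra.Bundles using (CommutativeMonoid)
open import Algebra.Properties.CommutativeSemigroup (CommutativeMonoid.commutativeSemigroup ∧-commutativeMonoid)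
  using () renaming (interchange to ∧-interchange)
import Algebra.Solver.CommutativeMonoid ∧-commutativeMonoid as ∧-Solver
open import Data.Nat.Tactic.RingSolver using (solve-∀)
open import Data.Product using (∃-syntax; _×_; _,_; proj₁; proj₂)
open import Data.Sum using (_⊎_; inj₁; inj₂)
open import Data.Unit using (⊤; tt)
open import Data.Empty using (⊥; ⊥-elim)
open import Function using (_∘_; _⇔_; mk⇔; Equivalence)
open import Relation.Binary.PropositionalEquality using (_≢_; refl; sym; trans; cong; cong₂; subst; module ≡-Reasoning)
open import Relation.Nullary using (¬_; yes; no; contradiction)
open import Relation.Nullary.Decidable using (T?)

open ≡-Reasoning

χ : Bool → ℕ
χ b = if b then 1 else 0

χ-∧ : (a b : Bool) → χ (a ∧ b) ≡ χ a * χ b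
χ-∧ true  b = sym (+-identityʳ (χ b))
χ-∧ false b = refl

χ-∨ : (a b : Bool) → (T a → T b → ⊥) → χ (a ∨ b) ≡ χ a + χ b
χ-∨ true  false _ = refl
χ-∨ true  true  disjoint = ⊥-elim (disjoint tt tt)
χ-∨ false b     _ = refl

T-ext : {a b : Bool} → (T a → T b) → (T b → T a) → a ≡ b
T-ext {false} {false} _ _ = refl
T-ext {false} {true}  _ g = ⊥-elim (g tt)
T-ext {true}  {false} f _ = ⊥-elim (f tt)
T-ext {true}  {true}  _ _ = refl

¬T⇒≡false : {b : Bool} → ¬ T b → b ≡ false
¬T⇒≡false {false} _  = refl
¬T⇒≡false {true}  ¬t = ⊥-elim (¬t tt)

T⇒≡true : {b : Bool} → T b → b ≡ true
T⇒≡true = Equivalence.to T-≡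

T-∧⁺ : {a b : Bool} → T a → T b → T (a ∧ b)
T-∧⁺ ta tb = Equivalence.from T-∧ (ta , tb)

T-∧⁻ : {a b : Bool} → T (a ∧ b) → T a × T b
T-∧⁻ = Equivalence.to T-∧

T-∨⁺ : {a b : Bool} → T a ⊎ T b → T (a ∨ b)
T-∨⁺ = Equivalence.from T-∨

T-∨⁻ : {a b : Bool} → T (a ∨ b) → T a ⊎ T b
T-∨⁻ = Equivalence.to T-∨

≡ᵇ-true⇒≡ : {a b : ℕ} → (a ≡ᵇ b) ≡ true → a ≡ b
≡ᵇ-true⇒≡ {a} {b} eq = ≡ᵇ⇒≡ a b (subst T (sym eq) tt)

χ-≡ᵇ-refl : (j : ℕ) → χ (j ≡ᵇ j) ≡ 1
χ-≡ᵇ-refl zero    = refl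
χ-≡ᵇ-refl (suc j) = χ-≡ᵇ-refl j

χ-≡ᵇ-≢ : {i j : ℕ} → i ≢ j → χ (i ≡ᵇ j) ≡ 0
χ-≡ᵇ-≢ {i} {j} i≢j with i ≡ᵇ j in eq
... | false = refl
... | true  = contradiction (≡ᵇ-true⇒≡ eq) i≢j

χ<ᵇsuc : (b c : ℕ) → χ (b <ᵇ suc c) ≡ χ (b <ᵇ c) + χ (b ≡ᵇ c)
χ<ᵇsuc zero    zero    = refl
χ<ᵇsuc zero    (suc c) = refl
χ<ᵇsuc (suc b) zero    = refl
χ<ᵇsuc (suc b) (suc c) = χ<ᵇsuc b c

1≤ᵇ+χ : (m : ℕ) (b : Bool) → (1 ≤ᵇ m + χ b) ≡ b ∨ (1 ≤ᵇ m)
1≤ᵇ+χ m true  = cong (1 ≤ᵇ_) (+-comm m 1)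
1≤ᵇ+χ m false = cong (1 ≤ᵇ_) (+-identityʳ m)

∑ : {A : Set} → List A → (A → ℕ) → ℕ
∑ []       f = 0
∑ (x ∷ xs) f = f x + ∑ xs f

syntax ∑ xs (λ x → e) = ∑[ x ∈ xs ] e

module _ {A : Set} where

  count≡∑χ : (p : A → Bool) (xs : List A) → countᵇ p xs ≡ ∑[ x ∈ xs ] χ (p x)
  count≡∑χ p []       = refl
  count≡∑χ p (x ∷ xs) with p x
  ... | true  = cong suc (count≡∑χ p xs)
  ... | false = count≡∑χ p xs

  count-∷ : (p : A → Bool) (x : A) (xs : List A) → countᵇ p (x ∷ xs) ≡ χ (p x) + countᵇ p xs
  count-∷ p x xs = trans (count≡∑χ p (x ∷ xs)) (cong (χ (p x) +_) (sym (count≡∑χ p xs)))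

  count-++ : (p : A → Bool) (xs ys : List A) → countᵇ p (xs ++ ys) ≡ countᵇ p xs + countᵇ p ys
  count-++ p [] ys = refl
  count-++ p (x ∷ xs) ys = begin
    countᵇ p (x ∷ xs ++ ys)                ≡⟨ count-∷ p x (xs ++ ys) ⟩
    χ (p x) + countᵇ p (xs ++ ys)          ≡⟨ cong (χ (p x) +_) (count-++ p xs ys) ⟩
    χ (p x) + (countᵇ p xs + countᵇ p ys)  ≡⟨ +-assoc (χ (p x)) _ _ ⟨
    (χ (p x) + countᵇ p xs) + countᵇ p ys  ≡⟨ cong (_+ countᵇ p ys) (count-∷ p x xs) ⟨
    countᵇ p (x ∷ xs) + countᵇ p ys        ∎

  count-all : {p : A → Bool} {xs : List A} → All (T ∘ p) xs → countᵇ p xs ≡ length xs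
  count-all {p} ps = cong length (filter-all (T? ∘ p) ps)

  count-none : {p : A → Bool} {xs : List A} → All (¬_ ∘ T ∘ p) xs → countᵇ p xs ≡ 0
  count-none {p} ps = cong length (filter-none (T? ∘ p) ps)

  ∑-cong-All : {xs : List A} {f g : A → ℕ} {P : A → Set} →
           (∀ {x} → P x → f x ≡ g x) → All P xs → ∑ xs f ≡ ∑ xs g
  ∑-cong-All f≡g []         = refl
  ∑-cong-All f≡g (px ∷ pxs) = cong₂ _+_ (f≡g px) (∑-cong-All f≡g pxs)

  ∑-cong : (xs : List A) {f g : A → ℕ} → (∀ x → f x ≡ g x) → ∑ xs f ≡ ∑ xs g
  ∑-cong []       f≡g = refl
  ∑-cong (x ∷ xs) f≡g = cong₂ _+_ (f≡g x) (∑-cong xs f≡g)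

  ∑-++ : (xs ys : List A) (f : A → ℕ) → ∑ (xs ++ ys) f ≡ ∑ xs f + ∑ ys f
  ∑-++ []       ys f = refl
  ∑-++ (x ∷ xs) ys f = trans (cong (f x +_) (∑-++ xs ys f)) (sym (+-assoc (f x) _ _))

  ∑-const : (xs : List A) (c : ℕ) → ∑[ x ∈ xs ] c ≡ length xs * c
  ∑-const []       c = refl
  ∑-const (x ∷ xs) c = cong (c +_) (∑-const xs c)

  ∑-zero : (xs : List A) → ∑[ x ∈ xs ] 0 ≡ 0
  ∑-zero xs = trans (∑-const xs 0) (*-zeroʳ (length xs))

  ∑-+ : (xs : List A) (f g : A → ℕ) → ∑[ x ∈ xs ] (f x + g x) ≡ ∑ xs f + ∑ xs g
  ∑-+ []       f g = refl
  ∑-+ (x ∷ xs) f g = trans (cong (f x + g x +_) (∑-+ xs f g)) (+-interchange (f x) (g x) _ _)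

  ∑-*ʳ : (xs : List A) (f : A → ℕ) (c : ℕ) → ∑ xs f * c ≡ ∑[ x ∈ xs ] (f x * c)
  ∑-*ʳ []       f c = refl
  ∑-*ʳ (x ∷ xs) f c = trans (*-distribʳ-+ c (f x) _) (cong (f x * c +_) (∑-*ʳ xs f c))

  ∑-χ∧ : (xs : List A) (b : Bool) (p : A → Bool) →
         ∑[ x ∈ xs ] χ (b ∧ p x) ≡ χ b * ∑[ x ∈ xs ] χ (p x)
  ∑-χ∧ xs true  p = sym (+-identityʳ _)
  ∑-χ∧ xs false p = ∑-zero xs

count-split : {A : Set} (r p q : A → Bool) (xs : List A) → (∀ x → χ (r x) ≡ χ (p x) + χ (q x)) →
              countᵇ r xs ≡ countᵇ p xs + countᵇ q xs
count-split r p q xs split = begin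
  countᵇ r xs                                    ≡⟨ count≡∑χ r xs ⟩
  ∑[ x ∈ xs ] χ (r x)                            ≡⟨ ∑-cong xs split ⟩
  ∑[ x ∈ xs ] (χ (p x) + χ (q x))                ≡⟨ ∑-+ xs _ _ ⟩
  ∑[ x ∈ xs ] χ (p x) + ∑[ x ∈ xs ] χ (q x)      ≡⟨ cong₂ _+_ (count≡∑χ p xs) (count≡∑χ q xs) ⟨
  countᵇ p xs + countᵇ q xs                      ∎

count-cong : {A : Set} {p q : A → Bool} (xs : List A) → (∀ x → p x ≡ q x) → countᵇ p xs ≡ countᵇ q xs
count-cong {p = p} {q} xs p≡q = trans (count≡∑χ p xs) (trans (∑-cong xs (cong χ ∘ p≡q)) (sym (count≡∑χ q xs)))

module _ {A B : Set} where

  ∑-map : (g : A → B) (xs : List A) (f : B → ℕ) → ∑ (map g xs) f ≡ ∑[ x ∈ xs ] f (g x)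
  ∑-map g []       f = refl
  ∑-map g (x ∷ xs) f = cong (f (g x) +_) (∑-map g xs f)

  ∑-concatMap : (g : A → List B) (xs : List A) (f : B → ℕ) →
                ∑ (concatMap g xs) f ≡ ∑[ x ∈ xs ] ∑ (g x) f
  ∑-concatMap g []       f = refl
  ∑-concatMap g (x ∷ xs) f = trans (∑-++ (g x) _ f) (cong (∑ (g x) f +_) (∑-concatMap g xs f))

  ∑-swap : (xs : List A) (ys : List B) (f : A → B → ℕ) →
           ∑[ x ∈ xs ] ∑[ y ∈ ys ] f x y ≡ ∑[ y ∈ ys ] ∑[ x ∈ xs ] f x y
  ∑-swap []       ys f = sym (∑-zero ys)
  ∑-swap (x ∷ xs) ys f = trans (cong (∑ ys (f x) +_) (∑-swap xs ys f)) (sym (∑-+ ys (f x) _))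

module _ {A : Set} where

  ∑-tuplesOver-suc : (xs : List A) (m : ℕ) (f : List A → ℕ) →
    ∑ (tuplesOver xs (suc m)) f ≡ ∑[ x ∈ xs ] ∑[ t ∈ tuplesOver xs m ] f (x ∷ t)
  ∑-tuplesOver-suc xs m f =
    trans (∑-concatMap _ xs f) (∑-cong xs (λ x → ∑-map (x ∷_) (tuplesOver xs m) f))

  tuplesOver-All : {P : A → Set} {xs : List A} → All P xs → (m : ℕ) →
                   All (λ t → All P t × length t ≡ m) (tuplesOver xs m)
  tuplesOver-All ps zero    = ([] , refl) ∷ []
  tuplesOver-All {P} {xs} ps (suc m) = concat⁺ (map⁺ (All.map extend ps))
    where
    extend : ∀ {x} → P x → All (λ t → All P t × length t ≡ suc m) (map (x ∷_) (tuplesOver xs m))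
    extend px = map⁺ (All.map (λ (pt , len) → (px ∷ pt , cong suc len)) (tuplesOver-All ps m))

all⁺ : {A : Set} {p : A → Bool} {xs : List A} → All (T ∘ p) xs → T (all p xs)
all⁺ []         = tt
all⁺ (px ∷ pxs) = T-∧⁺ px (all⁺ pxs)

all⁻ : {A : Set} {p : A → Bool} (xs : List A) → T (all p xs) → All (T ∘ p) xs
all⁻ []       _ = []
all⁻ (x ∷ xs) h = let (px , pxs) = T-∧⁻ h in px ∷ all⁻ xs pxs

module RangeFold (_∙_ : ℕ → ℕ → ℕ) (ε : ℕ)
  (∙-assoc : Associative _∙_) (∙-comm : Commutative _∙_) (∙-identityˡ : LeftIdentity ε _∙_) where

  fold< : ℕ → (ℕ → ℕ) → ℕ
  fold< zero    f = ε
  fold< (suc n) f = f 0 ∙ fold< n (f ∘ suc)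

  fold<-cong : (n : ℕ) {f g : ℕ → ℕ} → (∀ {i} → i < n → f i ≡ g i) → fold< n f ≡ fold< n g
  fold<-cong zero    f≡g = refl
  fold<-cong (suc n) f≡g = cong₂ _∙_ (f≡g z<s) (fold<-cong n (f≡g ∘ s<s))

  fold<-ε : (n : ℕ) {f : ℕ → ℕ} → (∀ {i} → i < n → f i ≡ ε) → fold< n f ≡ ε
  fold<-ε zero    f≡ε = refl
  fold<-ε (suc n) f≡ε = trans (cong₂ _∙_ (f≡ε z<s) (fold<-ε n (f≡ε ∘ s<s))) (∙-identityˡ ε)

  fold<-update : (n : ℕ) {j : ℕ} {f g : ℕ → ℕ} → j < n → (∀ {i} → i < n → i ≢ j → f i ≡ g i) →
                 fold< n f ∙ g j ≡ fold< n g ∙ f j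
  fold<-update (suc n) {zero} {f} {g} _ f≡g = begin
    (f 0 ∙ fold< n (f ∘ suc)) ∙ g 0
      ≡⟨ cong (λ s → (f 0 ∙ s) ∙ g 0) (fold<-cong n (λ i<n → f≡g (s<s i<n) (λ ()))) ⟩
    (f 0 ∙ fold< n (g ∘ suc)) ∙ g 0
      ≡⟨ swap-outer (f 0) _ (g 0) ⟩
    (g 0 ∙ fold< n (g ∘ suc)) ∙ f 0
      ∎
    where
    swap-outer : ∀ x y z → (x ∙ y) ∙ z ≡ (z ∙ y) ∙ x
    swap-outer x y z = trans (∙-comm (x ∙ y) z) (trans (cong (z ∙_) (∙-comm x y)) (sym (∙-assoc z y x)))
  fold<-update (suc n) {suc j} {f} {g} (s<s j<n) f≡g = begin
    (f 0 ∙ fold< n (f ∘ suc)) ∙ g (suc j)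
      ≡⟨ ∙-assoc (f 0) _ _ ⟩
    f 0 ∙ (fold< n (f ∘ suc) ∙ g (suc j))
      ≡⟨ cong₂ _∙_ (f≡g z<s (λ ())) (fold<-update n j<n (λ i<n i≢j → f≡g (s<s i<n) (i≢j ∘ suc-injective))) ⟩
    g 0 ∙ (fold< n (g ∘ suc) ∙ f (suc j))
      ≡⟨ ∙-assoc (g 0) _ _ ⟨
    (g 0 ∙ fold< n (g ∘ suc)) ∙ f (suc j)
      ∎

open RangeFold _+_ 0 +-assoc +-comm +-identityˡ public
  renaming (fold< to ∑<; fold<-cong to ∑<-cong; fold<-ε to ∑<-zero; fold<-update to ∑<-update)
open RangeFold _*_ 1 *-assoc *-comm *-identityˡ public
  renaming (fold< to ∏<; fold<-cong to ∏<-cong; fold<-ε to ∏<-one; fold<-update to ∏<-update)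

∑<-snoc : (n : ℕ) (f : ℕ → ℕ) → ∑< (suc n) f ≡ ∑< n f + f n
∑<-snoc zero    f = +-comm (f 0) 0
∑<-snoc (suc n) f = trans (cong (f 0 +_) (∑<-snoc n (f ∘ suc))) (sym (+-assoc (f 0) _ _))

∑<-*ʳ : (n : ℕ) (f : ℕ → ℕ) (c : ℕ) → ∑< n f * c ≡ ∑< n (λ i → f i * c)
∑<-*ʳ zero    f c = refl
∑<-*ʳ (suc n) f c = trans (*-distribʳ-+ c (f 0) _) (cong (f 0 * c +_) (∑<-*ʳ n (f ∘ suc) c))

∑<≡0⇒≡0 : (n : ℕ) {f : ℕ → ℕ} → ∑< n f ≡ 0 → ∀ {i} → i < n → f i ≡ 0
∑<≡0⇒≡0 (suc n) {f} ∑≡0 {zero}  _         = m+n≡0⇒m≡0 (f 0) ∑≡0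
∑<≡0⇒≡0 (suc n) {f} ∑≡0 {suc i} (s<s i<n) = ∑<≡0⇒≡0 n (m+n≡0⇒n≡0 (f 0) ∑≡0) i<n

∑<-+ : (s i : ℕ) (ν : ℕ → ℕ) → ∑< (s + i) ν ≡ ∑< s ν + ∑< i (λ j → ν (s + j))
∑<-+ zero    i ν = refl
∑<-+ (suc s) i ν = trans (cong (ν 0 +_) (∑<-+ s i (ν ∘ suc))) (sym (+-assoc (ν 0) _ _))

∑-applyUpTo : (g : ℕ → ℕ) (n : ℕ) (f : ℕ → ℕ) → ∑ (applyUpTo g n) f ≡ ∑< n (f ∘ g)
∑-applyUpTo g zero    f = refl
∑-applyUpTo g (suc n) f = cong (f (g 0) +_) (∑-applyUpTo (g ∘ suc) n f)

allN : ℕ → (ℕ → Bool) → Bool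
allN zero    p = true
allN (suc n) p = p 0 ∧ allN n (p ∘ suc)

all-applyUpTo : (g : ℕ → ℕ) (n : ℕ) (p : ℕ → Bool) → all p (applyUpTo g n) ≡ allN n (p ∘ g)
all-applyUpTo g zero    p = refl
all-applyUpTo g (suc n) p = cong (p (g 0) ∧_) (all-applyUpTo (g ∘ suc) n p)

allN⁺ : (n : ℕ) {p : ℕ → Bool} → (∀ {i} → i < n → T (p i)) → T (allN n p)
allN⁺ zero    _ = tt
allN⁺ (suc n) h = T-∧⁺ (h z<s) (allN⁺ n (h ∘ s<s))

allN⁻ : (n : ℕ) {p : ℕ → Bool} → T (allN n p) → ∀ {i} → i < n → T (p i)
allN⁻ (suc n) h {zero}  _         = proj₁ (T-∧⁻ h)
allN⁻ (suc n) h {suc i} (s<s i<n) = allN⁻ n (proj₂ (T-∧⁻ h)) i<n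

allN-cong : (n : ℕ) {p q : ℕ → Bool} → (∀ {i} → i < n → p i ≡ q i) → allN n p ≡ allN n q
allN-cong zero    _   = refl
allN-cong (suc n) p≡q = cong₂ _∧_ (p≡q z<s) (allN-cong n (p≡q ∘ s<s))

allN-∧ : (n : ℕ) (p q : ℕ → Bool) → allN n (λ i → p i ∧ q i) ≡ allN n p ∧ allN n q
allN-∧ zero    p q = refl
allN-∧ (suc n) p q = trans (cong ((p 0 ∧ q 0) ∧_) (allN-∧ n (p ∘ suc) (q ∘ suc))) (∧-interchange (p 0) (q 0) _ _)

-- Profiles of rankings

mult : List ℕ → ℕ → ℕ
mult α v = countᵇ (_≡ᵇ v) α

profile : List ℕ → ℕ → ℕ
profile α i = mult α (suc i)

data Rank (n : ℕ) : ℕ → Set where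
  rank : ∀ {i} → i < n → Rank n (suc i)

range1-ranks : (n : ℕ) → All (Rank n) (range1 n)
range1-ranks n = applyUpTo⁺₁ suc n rank

∈⇒1≤mult : {α : List ℕ} {v : ℕ} → v ∈ α → 1 ≤ mult α v
∈⇒1≤mult {v = v} v∈α = filter-some (T? ∘ (_≡ᵇ v)) (Any.map (λ { refl → ≡⇒≡ᵇ v v refl }) v∈α)

1≤mult⇒∈ : (α : List ℕ) {v : ℕ} → 1 ≤ mult α v → v ∈ α
1≤mult⇒∈ (a ∷ α) {v} h with a ≡ᵇ v in eq
... | true  = here (sym (≡ᵇ-true⇒≡ eq))
... | false = there (1≤mult⇒∈ α h)

mult-++ : (p q : List ℕ) (v : ℕ) → mult (p ++ q) v ≡ mult p v + mult q v
mult-++ p q v = count-++ (_≡ᵇ v) p q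

countBelow≡∑<profile : {n : ℕ} {α : List ℕ} → All (Rank n) α →
                       (i : ℕ) → countᵇ (_<ᵇ suc i) α ≡ ∑< i (profile α)
countBelow≡∑<profile ranks zero = count-none (All.map (λ { (rank _) () }) ranks)
countBelow≡∑<profile {α = α} ranks (suc i) = begin
  countᵇ (_<ᵇ suc (suc i)) α             ≡⟨ count-split _ _ _ α (λ b → χ<ᵇsuc b (suc i)) ⟩
  countᵇ (_<ᵇ suc i) α + profile α i     ≡⟨ cong (_+ profile α i) (countBelow≡∑<profile ranks i) ⟩
  ∑< i (profile α) + profile α i         ≡⟨ ∑<-snoc i (profile α) ⟨
  ∑< (suc i) (profile α)                 ∎

∑<profile≡length : {n : ℕ} {α : List ℕ} → All (Rank n) α → ∑< n (profile α) ≡ length α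
∑<profile≡length {n} ranks =
  trans (sym (countBelow≡∑<profile ranks n)) (count-all (All.map (λ { (rank i<n) → <⇒<ᵇ i<n }) ranks))

-- a = 1 + #{b < a} at an occupied rank a = i + 1, and at most two competitors per rank
UnitProfile : ℕ → (ℕ → ℕ) → Set
UnitProfile n ν = ∀ {i} → i < n → 1 ≤ ν i → ∑< i ν ≡ i × ν i ≤ 2

isUnitFubini⇔UnitProfile : {n : ℕ} (α : List ℕ) → All (Rank n) α →
                           T (isUnitFubiniᵇ α) ⇔ UnitProfile n (profile α)
isUnitFubini⇔UnitProfile {n} α ranks = mk⇔ to from
  where
  to : T (isUnitFubiniᵇ α) → UnitProfile n (profile α)
  to uf {i} i<n occurs =
    let (fub , twice) = T-∧⁻ uf
        i+1∈α = 1≤mult⇒∈ α occurs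
        rankOk = All.lookup (all⁻ α fub) i+1∈α
        tieOk = All.lookup (all⁻ α twice) i+1∈α
    in  sym (trans (suc-injective (≡ᵇ⇒≡ _ _ rankOk)) (countBelow≡∑<profile ranks i)) , ≤ᵇ⇒≤ _ 2 tieOk
  from : UnitProfile n (profile α) → T (isUnitFubiniᵇ α)
  from up = T-∧⁺ (all⁺ (All.tabulate rankOk)) (all⁺ (All.tabulate tieOk))
    where
    rankOk : ∀ {a} → a ∈ α → T (a ≡ᵇ suc (countᵇ (_<ᵇ a) α))
    rankOk a∈α with All.lookup ranks a∈α
    ... | rank {i} i<n =
      ≡⇒≡ᵇ i _ (sym (trans (countBelow≡∑<profile ranks i) (proj₁ (up i<n (∈⇒1≤mult a∈α)))))
    tieOk : ∀ {a} → a ∈ α → T (mult α a ≤ᵇ 2)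
    tieOk a∈α with All.lookup ranks a∈α
    ... | rank i<n = ≤⇒≤ᵇ (proj₂ (up i<n (∈⇒1≤mult a∈α)))

module _ (s : ℕ) {n : ℕ} {ν : ℕ → ℕ} (∑s : ∑< s ν ≡ s) where

  private
    ∑<-shift : ∀ i → ∑< (s + i) ν ≡ s + ∑< i (λ j → ν (s + j))
    ∑<-shift i = trans (∑<-+ s i ν) (cong (_+ ∑< i (λ j → ν (s + j))) ∑s)

  UnitProfile-drop : UnitProfile (s + n) ν → UnitProfile n (λ i → ν (s + i))
  UnitProfile-drop up {i} i<n occ =
    let (∑i , ≤2) = up (+-monoʳ-< s i<n) occ
    in  +-cancelˡ-≡ s _ _ (trans (sym (∑<-shift i)) ∑i) , ≤2

  UnitProfile-++ : UnitProfile s ν → UnitProfile n (λ i → ν (s + i)) → UnitProfile (s + n) ν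
  UnitProfile-++ up₁ up₂ {i} i<s+n occ with i <? s
  ... | yes i<s = up₁ i<s occ
  ... | no i≮s with m≤n⇒∃[o]m+o≡n (≮⇒≥ i≮s)
  ...   | j , refl = let (∑j , ≤2) = up₂ (+-cancelˡ-< s _ _ i<s+n) occ
                     in  trans (∑<-shift j) (cong (s +_) ∑j) , ≤2

∑<≡0-if-ahead : (n d : ℕ) {ν : ℕ → ℕ} →
                (∀ {i} → i < n → 1 ≤ ν i → ∑< i ν ≡ suc (d + i)) → ∑< n ν ≡ 0
∑<≡0-if-ahead zero    d ahead = refl
∑<≡0-if-ahead (suc n) d {ν} ahead with ν 0 in ν0
... | suc _ = contradiction (ahead z<s (subst (1 ≤_) (sym ν0) (s≤s z≤n))) (λ ())
... | zero  = ∑<≡0-if-ahead n (suc d) λ {i} i<n occ →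
                trans (sym (cong (_+ ∑< i (ν ∘ suc)) ν0))
                      (trans (ahead (s<s i<n) occ) (cong suc (+-suc d i)))

UnitProfile-single : {ν : ℕ → ℕ} → ν 0 ≡ 1 → UnitProfile 1 ν
UnitProfile-single ν0≡1 {zero} z<s _ = refl , subst (_≤ 2) (sym ν0≡1) (s≤s z≤n)

UnitProfile-pair : {ν : ℕ → ℕ} → ν 0 ≡ 2 → ν 1 ≡ 0 → UnitProfile 2 ν
UnitProfile-pair ν0≡2 ν1≡0 {zero}     z<s _   = refl , subst (_≤ 2) (sym ν0≡2) ≤-refl
UnitProfile-pair ν0≡2 ν1≡0 {suc zero} (s<s z<s) occ = contradiction (subst (1 ≤_) ν1≡0 occ) λ ()

_◂_ : ℕ → (ℕ → ℕ) → ℕ → ℕ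
(x ◂ σ) zero    = x
(x ◂ σ) (suc i) = σ i

infixr 5 _◂_

-- the sequences of k blocks 1 (a single competitor) and 2 ◂ 0 (a tie) covering n ranks
shapes pairShapes : ℕ → ℕ → List (ℕ → ℕ)
shapes zero    zero    = (λ _ → 0) ∷ []
shapes zero    (suc k) = []
shapes (suc n) zero    = []
shapes (suc n) (suc k) = map (1 ◂_) (shapes n k) ++ pairShapes n k
pairShapes zero    k = []
pairShapes (suc n) k = map (λ σ → 2 ◂ 0 ◂ σ) (shapes n k)

isShapeᵇ isPairShapeᵇ : ℕ → ℕ → (ℕ → ℕ) → Bool
isShapeᵇ zero    zero    ν = true
isShapeᵇ zero    (suc k) ν = false
isShapeᵇ (suc n) zero    ν = false
isShapeᵇ (suc n) (suc k) ν = ((ν 0 ≡ᵇ 1) ∧ isShapeᵇ n k (ν ∘ suc)) ∨ isPairShapeᵇ n k ν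
isPairShapeᵇ zero    k ν = false
isPairShapeᵇ (suc n) k ν = (ν 0 ≡ᵇ 2) ∧ ((ν 1 ≡ᵇ 0) ∧ isShapeᵇ n k (ν ∘ suc ∘ suc))

agreeᵇ : ℕ → (ℕ → ℕ) → (ℕ → ℕ) → Bool
agreeᵇ n ν σ = allN n (λ i → ν i ≡ᵇ σ i)

isPairShape-head : (n : ℕ) {k : ℕ} {ν : ℕ → ℕ} → T (isPairShapeᵇ n k ν) → ν 0 ≡ 2
isPairShape-head (suc n) pair = ≡ᵇ⇒≡ _ 2 (proj₁ (T-∧⁻ pair))

isShape-matches : (n k : ℕ) (ν : ℕ → ℕ) → χ (isShapeᵇ n k ν) ≡ ∑[ σ ∈ shapes n k ] χ (agreeᵇ n ν σ)
isPairShape-matches : (n k : ℕ) (ν : ℕ → ℕ) →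
  χ (isPairShapeᵇ n k ν) ≡ ∑[ σ ∈ pairShapes n k ] χ (agreeᵇ (suc n) ν σ)
isShape-matches zero    zero    ν = refl
isShape-matches zero    (suc k) ν = refl
isShape-matches (suc n) zero    ν = refl
isShape-matches (suc n) (suc k) ν = begin
  χ (((ν 0 ≡ᵇ 1) ∧ isShapeᵇ n k (ν ∘ suc)) ∨ isPairShapeᵇ n k ν)
    ≡⟨ χ-∨ _ _ (λ single pair → contradiction (trans (sym (head-single single)) (isPairShape-head n pair)) λ ()) ⟩
  χ ((ν 0 ≡ᵇ 1) ∧ isShapeᵇ n k (ν ∘ suc)) + χ (isPairShapeᵇ n k ν)
    ≡⟨ cong₂ _+_ (trans (χ-∧ (ν 0 ≡ᵇ 1) _) (cong (χ (ν 0 ≡ᵇ 1) *_) (isShape-matches n k (ν ∘ suc))))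
                 (isPairShape-matches n k ν) ⟩
  χ (ν 0 ≡ᵇ 1) * ∑[ σ ∈ shapes n k ] χ (agreeᵇ n (ν ∘ suc) σ) + pairs
    ≡⟨ cong (_+ pairs) (trans (sym (∑-χ∧ (shapes n k) (ν 0 ≡ᵇ 1) _)) (sym (∑-map (1 ◂_) (shapes n k) _))) ⟩
  ∑[ σ ∈ map (1 ◂_) (shapes n k) ] χ (agreeᵇ (suc n) ν σ) + pairs
    ≡⟨ ∑-++ (map (1 ◂_) (shapes n k)) _ _ ⟨
  ∑[ σ ∈ shapes (suc n) (suc k) ] χ (agreeᵇ (suc n) ν σ)
    ∎
  where
  pairs : ℕ
  pairs = ∑[ σ ∈ pairShapes n k ] χ (agreeᵇ (suc n) ν σ)
  head-single : T ((ν 0 ≡ᵇ 1) ∧ isShapeᵇ n k (ν ∘ suc)) → ν 0 ≡ 1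
  head-single single = ≡ᵇ⇒≡ _ 1 (proj₁ (T-∧⁻ single))
isPairShape-matches zero    k ν = refl
isPairShape-matches (suc n) k ν = begin
  χ ((ν 0 ≡ᵇ 2) ∧ ((ν 1 ≡ᵇ 0) ∧ isShapeᵇ n k (ν ∘ suc ∘ suc)))
    ≡⟨ trans (χ-∧ (ν 0 ≡ᵇ 2) _) (cong (χ (ν 0 ≡ᵇ 2) *_) (χ-∧ (ν 1 ≡ᵇ 0) _)) ⟩
  χ (ν 0 ≡ᵇ 2) * (χ (ν 1 ≡ᵇ 0) * χ (isShapeᵇ n k (ν ∘ suc ∘ suc)))
    ≡⟨ cong (λ c → χ (ν 0 ≡ᵇ 2) * (χ (ν 1 ≡ᵇ 0) * c)) (isShape-matches n k (ν ∘ suc ∘ suc)) ⟩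
  χ (ν 0 ≡ᵇ 2) * (χ (ν 1 ≡ᵇ 0) * ∑[ σ ∈ shapes n k ] χ (agreeᵇ n (ν ∘ suc ∘ suc) σ))
    ≡⟨ trans (cong (χ (ν 0 ≡ᵇ 2) *_) (sym (∑-χ∧ (shapes n k) (ν 1 ≡ᵇ 0) _)))
             (sym (∑-χ∧ (shapes n k) (ν 0 ≡ᵇ 2) _)) ⟩
  ∑[ σ ∈ shapes n k ] χ (agreeᵇ (suc (suc n)) ν (2 ◂ 0 ◂ σ))
    ≡⟨ ∑-map (λ σ → 2 ◂ 0 ◂ σ) (shapes n k) _ ⟨
  ∑[ σ ∈ pairShapes (suc n) k ] χ (agreeᵇ (suc (suc n)) ν σ)
    ∎

nonzeroCount : ℕ → (ℕ → ℕ) → ℕ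
nonzeroCount n ν = ∑< n (λ i → χ (1 ≤ᵇ ν i))

ShapeProfile : ℕ → ℕ → (ℕ → ℕ) → Set
ShapeProfile n k ν = UnitProfile n ν × ∑< n ν ≡ n × nonzeroCount n ν ≡ k

isShape-sound : (n k : ℕ) (ν : ℕ → ℕ) → T (isShapeᵇ n k ν) → ShapeProfile n k ν
isShape-sound zero    zero    ν _ = (λ ()) , refl , refl
isShape-sound (suc n) (suc k) ν shape with T-∨⁻ shape
... | inj₁ single =
  let (head , rest) = T-∧⁻ single
      ν0≡1 = ≡ᵇ⇒≡ (ν 0) 1 head
      (up , ∑n , nz) = isShape-sound n k (ν ∘ suc) rest
  in  UnitProfile-++ 1 (cong (_+ 0) ν0≡1) (UnitProfile-single ν0≡1) up ,
      cong₂ _+_ ν0≡1 ∑n ,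
      cong₂ _+_ (cong (λ x → χ (1 ≤ᵇ x)) ν0≡1) nz
isShape-sound (suc (suc n)) (suc k) ν shape | inj₂ pair =
  let (head , tail) = T-∧⁻ pair
      (second , rest) = T-∧⁻ tail
      ν0≡2 = ≡ᵇ⇒≡ (ν 0) 2 head
      ν1≡0 = ≡ᵇ⇒≡ (ν 1) 0 second
      (up , ∑n , nz) = isShape-sound n k (ν ∘ suc ∘ suc) rest
  in  UnitProfile-++ 2 (cong₂ (λ x y → x + (y + 0)) ν0≡2 ν1≡0) (UnitProfile-pair ν0≡2 ν1≡0) up ,
      cong₂ _+_ ν0≡2 (cong₂ _+_ ν1≡0 ∑n) ,
      cong₂ _+_ (cong (λ x → χ (1 ≤ᵇ x)) ν0≡2) (cong₂ _+_ (cong (λ x → χ (1 ≤ᵇ x)) ν1≡0) nz)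

UnitProfile-firstBlock : (n : ℕ) {ν : ℕ → ℕ} → UnitProfile (suc n) ν → ∑< (suc n) ν ≡ suc n →
             ν 0 ≡ 1 ⊎ (ν 0 ≡ 2 × ν 1 ≡ 0 × ∃[ m ] n ≡ suc m)
UnitProfile-firstBlock n {ν} up ∑n with ν 0 in ν0
... | 0 = ⊥-elim (0≢1+n (trans (sym rest≡0) ∑n))
  where
  rest≡0 : ∑< n (ν ∘ suc) ≡ 0
  rest≡0 = ∑<≡0-if-ahead n 0 λ {i} i<n occ →
    trans (cong (_+ ∑< i (ν ∘ suc)) (sym ν0)) (proj₁ (up (s<s i<n) occ))
... | 1 = inj₁ refl
... | suc (suc (suc _)) =
  contradiction (subst (_≤ 2) ν0 (proj₂ (up z<s (subst (1 ≤_) (sym ν0) (s≤s z≤n))))) λ { (s≤s (s≤s ())) }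
... | 2 with n | ν 1 in ν1
...   | zero  | _     = contradiction ∑n λ ()
...   | suc m | zero  = inj₂ (refl , refl , m , refl)
...   | suc m | suc _ =
  contradiction (trans (sym (cong (_+ 0) ν0)) (proj₁ (up (s<s z<s) (subst (1 ≤_) (sym ν1) (s≤s z≤n))))) λ ()

isShape-complete : (n : ℕ) {ν : ℕ → ℕ} → UnitProfile n ν → ∑< n ν ≡ n → T (isShapeᵇ n (nonzeroCount n ν) ν)
isShape-complete zero    _  _  = tt
isShape-complete (suc n) {ν} up ∑n with UnitProfile-firstBlock n up ∑n
... | inj₁ ν0≡1 =
  subst (λ k → T (isShapeᵇ (suc n) k ν)) (cong (λ x → χ (1 ≤ᵇ x) + nonzeroCount n ν′) (sym ν0≡1))
        (T-∨⁺ (inj₁ (T-∧⁺ (≡⇒≡ᵇ (ν 0) 1 ν0≡1) (isShape-complete n up′ ∑n′))))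
  where
  ν′ : ℕ → ℕ
  ν′ = ν ∘ suc
  up′ : UnitProfile n ν′
  up′ = UnitProfile-drop 1 (cong (_+ 0) ν0≡1) up
  ∑n′ : ∑< n ν′ ≡ n
  ∑n′ = suc-injective (trans (cong (_+ ∑< n ν′) (sym ν0≡1)) ∑n)
... | inj₂ (ν0≡2 , ν1≡0 , m , refl) =
  subst (λ k → T (isShapeᵇ (suc (suc m)) k ν))
        (cong₂ (λ x y → χ (1 ≤ᵇ x) + (χ (1 ≤ᵇ y) + nonzeroCount m ν″)) (sym ν0≡2) (sym ν1≡0))
        (T-∨⁺ (inj₂ (T-∧⁺ (≡⇒≡ᵇ (ν 0) 2 ν0≡2)
                          (T-∧⁺ (≡⇒≡ᵇ (ν 1) 0 ν1≡0) (isShape-complete m up″ ∑m)))))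
  where
  ν″ : ℕ → ℕ
  ν″ = ν ∘ suc ∘ suc
  up″ : UnitProfile m ν″
  up″ = UnitProfile-drop 2 (cong₂ (λ x y → x + (y + 0)) ν0≡2 ν1≡0) up
  ∑m : ∑< m ν″ ≡ m
  ∑m = suc-injective (suc-injective (trans (cong₂ (λ x y → x + (y + ∑< m ν″)) (sym ν0≡2) (sym ν1≡0)) ∑n))

-- Parking and lucky cars

mult-snoc : (p : List ℕ) (a s : ℕ) → mult (p ++ [ a ]) s ≡ mult p s + χ (a ≡ᵇ s)
mult-snoc p a s = trans (mult-++ p [ a ] s) (cong (mult p s +_) (trans (count-∷ (_≡ᵇ s) a []) (+-identityʳ _)))

-- the spots occupied once the cars p of a unit Fubini ranking have parked: the preferred ones,
-- and the spot after each tied pair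
taken : List ℕ → ℕ → Bool
taken p zero    = 1 ≤ᵇ mult p 0
taken p (suc v) = (1 ≤ᵇ mult p (suc v)) ∨ (2 ≤ᵇ mult p v)

taken-snoc-fresh : (p : List ℕ) (a : ℕ) → mult p a ≡ 0 → ∀ s → taken (p ++ [ a ]) s ≡ (a ≡ᵇ s) ∨ taken p s
taken-snoc-fresh p a fresh zero    = trans (cong (1 ≤ᵇ_) (mult-snoc p a 0)) (1≤ᵇ+χ (mult p 0) (a ≡ᵇ 0))
taken-snoc-fresh p a fresh (suc v) = begin
  (1 ≤ᵇ mult (p ++ [ a ]) (suc v)) ∨ (2 ≤ᵇ mult (p ++ [ a ]) v)
    ≡⟨ cong₂ _∨_ (trans (cong (1 ≤ᵇ_) (mult-snoc p a (suc v))) (1≤ᵇ+χ (mult p (suc v)) (a ≡ᵇ suc v)))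
                 (trans (cong (2 ≤ᵇ_) (mult-snoc p a v)) second) ⟩
  ((a ≡ᵇ suc v) ∨ (1 ≤ᵇ mult p (suc v))) ∨ (2 ≤ᵇ mult p v)
    ≡⟨ ∨-assoc (a ≡ᵇ suc v) _ _ ⟩
  (a ≡ᵇ suc v) ∨ taken p (suc v)
    ∎
  where
  second : (2 ≤ᵇ mult p v + χ (a ≡ᵇ v)) ≡ (2 ≤ᵇ mult p v)
  second with a ≡ᵇ v in a≡v
  ... | false = cong (2 ≤ᵇ_) (+-identityʳ (mult p v))
  ... | true = let none = trans (cong (mult p) (sym (≡ᵇ-true⇒≡ a≡v))) fresh
                in  trans (cong (λ m → 2 ≤ᵇ m + 1) none) (cong (2 ≤ᵇ_) (sym none))

≡ᵇ-∨-occurs : (p : List ℕ) {a : ℕ} → 1 ≤ mult p a →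
              ∀ s → (a ≡ᵇ s) ∨ (1 ≤ᵇ mult p s) ≡ (1 ≤ᵇ mult p s)
≡ᵇ-∨-occurs p {a} occurs s with a ≡ᵇ s in a≡s
... | false = refl
... | true  = sym (T⇒≡true (≤⇒≤ᵇ (subst (λ x → 1 ≤ mult p x) (≡ᵇ-true⇒≡ a≡s) occurs)))

taken-snoc-second : (p : List ℕ) (a : ℕ) → mult p a ≡ 1 →
                    ∀ s → taken (p ++ [ a ]) s ≡ (suc a ≡ᵇ s) ∨ taken p s
taken-snoc-second p a once zero =
  trans (cong (1 ≤ᵇ_) (mult-snoc p a 0))
        (trans (1≤ᵇ+χ (mult p 0) (a ≡ᵇ 0)) (≡ᵇ-∨-occurs p (≤-reflexive (sym once)) 0))
taken-snoc-second p a once (suc v) = begin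
  (1 ≤ᵇ mult (p ++ [ a ]) (suc v)) ∨ (2 ≤ᵇ mult (p ++ [ a ]) v)
    ≡⟨ cong₂ _∨_ (trans (cong (1 ≤ᵇ_) (mult-snoc p a (suc v)))
                        (trans (1≤ᵇ+χ (mult p (suc v)) (a ≡ᵇ suc v))
                               (≡ᵇ-∨-occurs p (≤-reflexive (sym once)) (suc v))))
                 (cong (2 ≤ᵇ_) (mult-snoc p a v)) ⟩
  (1 ≤ᵇ mult p (suc v)) ∨ (2 ≤ᵇ mult p v + χ (a ≡ᵇ v))
    ≡⟨ second ⟩
  (a ≡ᵇ v) ∨ taken p (suc v)
    ∎
  where
  second : (1 ≤ᵇ mult p (suc v)) ∨ (2 ≤ᵇ mult p v + χ (a ≡ᵇ v)) ≡ (a ≡ᵇ v) ∨ taken p (suc v)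
  second with a ≡ᵇ v in a≡v
  ... | false = cong (λ m → (1 ≤ᵇ mult p (suc v)) ∨ (2 ≤ᵇ m)) (+-identityʳ (mult p v))
  ... | true  = trans (cong (λ m → (1 ≤ᵇ mult p (suc v)) ∨ (2 ≤ᵇ m + 1))
                            (trans (cong (mult p) (sym (≡ᵇ-true⇒≡ a≡v))) once))
                      (∨-zeroʳ _)

nonzeroCount-snoc : (n : ℕ) (p : List ℕ) {j : ℕ} → j < n →
  nonzeroCount n (profile (p ++ [ suc j ])) ≡ (if 1 ≤ᵇ mult p (suc j) then 0 else 1) + nonzeroCount n (profile p)
nonzeroCount-snoc n p {j} j<n =
  cancel (mult p (suc j)) (trans (∑<-update n j<n unchanged-off-j) (cong (_ +_) now-occupied))
  where
  unchanged-off-j : ∀ {i} → i < n → i ≢ j →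
    χ (1 ≤ᵇ profile (p ++ [ suc j ]) i) ≡ χ (1 ≤ᵇ profile p i)
  unchanged-off-j {i} _ i≢j = cong (λ m → χ (1 ≤ᵇ m))
    (trans (mult-snoc p (suc j) (suc i)) (trans (cong (mult p (suc i) +_) (χ-≡ᵇ-≢ (i≢j ∘ sym))) (+-identityʳ _)))
  now-occupied : χ (1 ≤ᵇ profile (p ++ [ suc j ]) j) ≡ 1
  now-occupied = cong (λ m → χ (1 ≤ᵇ m))
    (trans (mult-snoc p (suc j) (suc j)) (trans (cong (mult p (suc j) +_) (χ-≡ᵇ-refl j)) (+-comm _ 1)))
  cancel : ∀ m {x y} → x + χ (1 ≤ᵇ m) ≡ y + 1 → x ≡ (if 1 ≤ᵇ m then 0 else 1) + y
  cancel zero    {x} {y} eq = trans (sym (+-identityʳ x)) (trans eq (+-comm y 1))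
  cancel (suc m) {x} {y} eq = +-cancelʳ-≡ 1 x y eq

record UnitTies (τ : List ℕ) : Set where
  field
    atMostTwice    : ∀ v → mult τ v ≤ 2
    vacantAfterTie : ∀ v → mult τ v ≡ 2 → mult τ (suc v) ≡ 0

UnitProfile⇒UnitTies : {n : ℕ} (α : List ℕ) → All (Rank n) α → UnitProfile n (profile α) → UnitTies α
UnitProfile⇒UnitTies {n} α ranks up = record { atMostTwice = atMostTwice ; vacantAfterTie = vacantAfterTie }
  where
  atMostTwice : ∀ v → mult α v ≤ 2
  atMostTwice v with mult α v in m
  ... | zero  = z≤n
  ... | suc _ with All.lookup ranks (1≤mult⇒∈ α (subst (1 ≤_) (sym m) (s≤s z≤n)))
  ...   | rank i<n = subst (_≤ 2) m (proj₂ (up i<n (subst (1 ≤_) (sym m) (s≤s z≤n))))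
  vacantAfterTie : ∀ v → mult α v ≡ 2 → mult α (suc v) ≡ 0
  vacantAfterTie v two with mult α (suc v) in m
  ... | zero  = refl
  ... | suc _ with All.lookup ranks (1≤mult⇒∈ α (subst (1 ≤_) (sym m) (s≤s z≤n)))
                 | All.lookup ranks (1≤mult⇒∈ α (subst (1 ≤_) (sym two) (s≤s z≤n)))
  ...   | rank {suc j} j+1<n | rank j<n = contradiction (begin
          suc j                       ≡⟨ proj₁ (up j+1<n (subst (1 ≤_) (sym m) (s≤s z≤n))) ⟨
          ∑< (suc j) (profile α)      ≡⟨ ∑<-snoc j (profile α) ⟩
          ∑< j (profile α) + mult α v ≡⟨ cong₂ _+_ (proj₁ (up j<n (subst (1 ≤_) (sym two) (s≤s z≤n)))) two ⟩
          j + 2                       ∎) (λ eq → contradiction (+-cancelˡ-≡ j 1 2 (trans (+-comm j 1) eq)) λ ())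

parkSpot-free : (occ : List ℕ) {a : ℕ} → occupiedᵇ occ a ≡ false → parkSpot occ a ≡ a
parkSpot-free occ free rewrite free = refl

parkSpot-next : (occ : List ℕ) {a : ℕ} → occupiedᵇ occ a ≡ true → occupiedᵇ occ (suc a) ≡ false →
                parkSpot occ a ≡ suc a
parkSpot-next []      ()
parkSpot-next (_ ∷ _) full next-free rewrite full | next-free = refl

module Parking {τ : List ℕ} (ties : UnitTies τ) where

  open UnitTies ties

  Invariant : List ℕ → List ℕ → Set
  Invariant occ p = ∀ s → occupiedᵇ occ s ≡ taken p s

  mult-prefix : (p q : List ℕ) → p ++ q ≡ τ → ∀ v → mult p v + mult q v ≡ mult τ v
  mult-prefix p q refl v = sym (mult-++ p q v)

  mult-prefix-≤ : (p q : List ℕ) → p ++ q ≡ τ → ∀ v → mult p v ≤ mult τ v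
  mult-prefix-≤ p q pre v = subst (mult p v ≤_) (mult-prefix p q pre v) (m≤m+n (mult p v) (mult q v))

  -- the second disjunct of taken could only come from a tie on s - 1, which leaves s unused
  taken-occurring : (p q : List ℕ) → p ++ q ≡ τ → ∀ {s} → 1 ≤ mult τ s → taken p s ≡ (1 ≤ᵇ mult p s)
  taken-occurring p q pre {zero}  _ = refl
  taken-occurring p q pre {suc v} occurs with 2 ≤ᵇ mult p v in full
  ... | false = ∨-identityʳ (1 ≤ᵇ mult p (suc v))
  ... | true  = contradiction (subst (1 ≤_) (vacantAfterTie v (≤-antisym (atMostTwice v) tie)) occurs) λ ()
    where
    tie : 2 ≤ mult τ v
    tie = ≤-trans (≤ᵇ⇒≤ 2 _ (subst T (sym full) tt)) (mult-prefix-≤ p q pre v)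

  mult-before : (p as : List ℕ) {a : ℕ} → p ++ a ∷ as ≡ τ → mult p a + 1 ≤ mult τ a
  mult-before p as {a} pre =
    subst (mult p a + 1 ≤_) (mult-prefix p (a ∷ as) pre a) (+-monoʳ-≤ (mult p a) (∈⇒1≤mult {a ∷ as} (here refl)))

  second-of-tie : (p as : List ℕ) {a : ℕ} → p ++ a ∷ as ≡ τ → 1 ≤ mult p a → mult p a ≡ 1 × mult p (suc a) ≡ 0
  second-of-tie p as {a} pre seen =
    once , n≤0⇒n≡0 (subst (mult p (suc a) ≤_) (vacantAfterTie a tie) (mult-prefix-≤ p (a ∷ as) pre (suc a)))
    where
    once : mult p a ≡ 1
    once = ≤-antisym (+-cancelʳ-≤ 1 (mult p a) 1 (≤-trans (mult-before p as pre) (atMostTwice a))) seen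
    tie : mult τ a ≡ 2
    tie = ≤-antisym (atMostTwice a) (subst (λ x → x + 1 ≤ mult τ a) once (mult-before p as pre))

  park-step : {p as occ : List ℕ} {a : ℕ} → p ++ a ∷ as ≡ τ → Invariant occ p →
              occupiedᵇ occ a ≡ (1 ≤ᵇ mult p a) × Invariant (parkSpot occ a ∷ occ) (p ++ [ a ])
  park-step {p} {as} {occ} {a} pre inv = occupied-a , invariant′
    where
    occupied-a : occupiedᵇ occ a ≡ (1 ≤ᵇ mult p a)
    occupied-a = trans (inv a) (taken-occurring p (a ∷ as) pre (≤-trans (m≤n+m 1 (mult p a)) (mult-before p as pre)))
    invariant′ : Invariant (parkSpot occ a ∷ occ) (p ++ [ a ])
    invariant′ with mult p a in m
    ... | zero = λ s → begin
      (parkSpot occ a ≡ᵇ s) ∨ occupiedᵇ occ s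
        ≡⟨ cong₂ (λ q o → (q ≡ᵇ s) ∨ o) (parkSpot-free occ free) (inv s) ⟩
      (a ≡ᵇ s) ∨ taken p s
        ≡⟨ taken-snoc-fresh p a m s ⟨
      taken (p ++ [ a ]) s
        ∎
      where
      free : occupiedᵇ occ a ≡ false
      free = trans occupied-a (cong (1 ≤ᵇ_) m)
    ... | suc _ = λ s → begin
      (parkSpot occ a ≡ᵇ s) ∨ occupiedᵇ occ s
        ≡⟨ cong₂ (λ q o → (q ≡ᵇ s) ∨ o) (parkSpot-next occ full next-free) (inv s) ⟩
      (suc a ≡ᵇ s) ∨ taken p s
        ≡⟨ taken-snoc-second p a once s ⟨
      taken (p ++ [ a ]) s
        ∎
      where
      once : mult p a ≡ 1
      once = proj₁ (second-of-tie p as pre (subst (1 ≤_) (sym m) (s≤s z≤n)))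
      full : occupiedᵇ occ a ≡ true
      full = trans occupied-a (cong (1 ≤ᵇ_) m)
      next-free : occupiedᵇ occ (suc a) ≡ false
      next-free = trans (inv (suc a)) (cong₂ (λ x y → (1 ≤ᵇ x) ∨ (2 ≤ᵇ y))
                                             (proj₂ (second-of-tie p as pre (subst (1 ≤_) (sym m) (s≤s z≤n)))) once)

  luckyFrom-prefix : (n : ℕ) {p as occ : List ℕ} → All (Rank n) as → p ++ as ≡ τ → Invariant occ p →
                     luckyFrom occ as + nonzeroCount n (profile p) ≡ nonzeroCount n (profile τ)
  luckyFrom-prefix n {p} [] pre _ = cong (nonzeroCount n ∘ profile) (trans (sym (++-identityʳ p)) pre)
  luckyFrom-prefix n {p} {a ∷ as} {occ} (rank {j} j<n ∷ ranks) pre inv =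
    let (occupied-a , inv′) = park-step {p} {as} {occ} {a} pre inv
        new = if 1 ≤ᵇ mult p a then 0 else 1
        rest = luckyFrom (parkSpot occ a ∷ occ) as
    in begin
      (if occupiedᵇ occ a then 0 else 1) + rest + nonzeroCount n (profile p)
        ≡⟨ cong (λ b → (if b then 0 else 1) + rest + nonzeroCount n (profile p)) occupied-a ⟩
      new + rest + nonzeroCount n (profile p)
        ≡⟨ trans (cong (_+ nonzeroCount n (profile p)) (+-comm new rest)) (+-assoc rest new _) ⟩
      rest + (new + nonzeroCount n (profile p))
        ≡⟨ cong (rest +_) (nonzeroCount-snoc n p j<n) ⟨
      rest + nonzeroCount n (profile (p ++ [ a ]))
        ≡⟨ luckyFrom-prefix n ranks (trans (++-assoc p [ a ] as) pre) inv′ ⟩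
      nonzeroCount n (profile τ)
        ∎

luckyCount≡nonzeroCount : {n : ℕ} (α : List ℕ) → All (Rank n) α → UnitProfile n (profile α) →
                          luckyCount α ≡ nonzeroCount n (profile α)
luckyCount≡nonzeroCount {n} α ranks up =
  trans (sym (+-identityʳ (luckyCount α)))
        (trans (cong (luckyCount α +_) (sym (∑<-zero n (λ _ → refl))))
               (Parking.luckyFrom-prefix (UnitProfile⇒UnitTies α ranks up) n ranks refl nothing-taken))
  where
  nothing-taken : ∀ s → occupiedᵇ [] s ≡ taken [] s
  nothing-taken zero    = refl
  nothing-taken (suc s) = refl

-- Counting unit Fubini rankings

unitFubiniWithLucky≡isShape : {n : ℕ} (k : ℕ) (α : List ℕ) → All (Rank n) α → length α ≡ n →
                              (isUnitFubiniᵇ α ∧ (luckyCount α ≡ᵇ k)) ≡ isShapeᵇ n k (profile α)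
unitFubiniWithLucky≡isShape {n} k α ranks len = T-ext to from
  where
  open Equivalence (isUnitFubini⇔UnitProfile α ranks) renaming (to to profileOf; from to unitFubiniOf)
  to : T (isUnitFubiniᵇ α ∧ (luckyCount α ≡ᵇ k)) → T (isShapeᵇ n k (profile α))
  to h = let (uf , lucky) = T-∧⁻ h
             up = profileOf uf
         in  subst (λ k → T (isShapeᵇ n k (profile α)))
                   (trans (sym (luckyCount≡nonzeroCount α ranks up)) (≡ᵇ⇒≡ _ k lucky))
                   (isShape-complete n up (trans (∑<profile≡length ranks) len))
  from : T (isShapeᵇ n k (profile α)) → T (isUnitFubiniᵇ α ∧ (luckyCount α ≡ᵇ k))
  from shape = let (up , _ , nz) = isShape-sound n k (profile α) shape
               in  T-∧⁺ (unitFubiniOf up) (≡⇒≡ᵇ _ k (trans (luckyCount≡nonzeroCount α ranks up) nz))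

wordsWithProfile : ℕ → ℕ → (ℕ → ℕ) → ℕ
wordsWithProfile n m ν = countᵇ (λ t → agreeᵇ n (profile t) ν) (tuplesOver (range1 n) m)

fUFR≡∑wordsWithProfile : (n k : ℕ) → fUFR n k ≡ ∑[ σ ∈ shapes n k ] wordsWithProfile n n σ
fUFR≡∑wordsWithProfile n k = begin
  fUFR n k
    ≡⟨ count≡∑χ _ (allTuples n) ⟩
  ∑[ α ∈ allTuples n ] χ (isUnitFubiniᵇ α ∧ (luckyCount α ≡ᵇ k))
    ≡⟨ ∑-cong-All (λ (ranks , len) → cong χ (unitFubiniWithLucky≡isShape k _ ranks len))
                  (tuplesOver-All (range1-ranks n) n) ⟩
  ∑[ α ∈ allTuples n ] χ (isShapeᵇ n k (profile α))
    ≡⟨ ∑-cong (allTuples n) (λ α → isShape-matches n k (profile α)) ⟩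
  ∑[ α ∈ allTuples n ] ∑[ σ ∈ shapes n k ] χ (agreeᵇ n (profile α) σ)
    ≡⟨ ∑-swap (allTuples n) (shapes n k) _ ⟩
  ∑[ σ ∈ shapes n k ] ∑[ α ∈ allTuples n ] χ (agreeᵇ n (profile α) σ)
    ≡⟨ ∑-cong (shapes n k) (λ σ → count≡∑χ _ (allTuples n)) ⟨
  ∑[ σ ∈ shapes n k ] wordsWithProfile n n σ
    ∎

removeOne : (ℕ → ℕ) → ℕ → ℕ → ℕ
removeOne ν j i = ν i ∸ χ (j ≡ᵇ i)

profile-∷ : (j : ℕ) (t : List ℕ) (i : ℕ) → profile (suc j ∷ t) i ≡ χ (j ≡ᵇ i) + profile t i
profile-∷ j t i = count-∷ (_≡ᵇ suc i) (suc j) t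

χ≡ᵇ≤ : {ν : ℕ → ℕ} {j : ℕ} → 1 ≤ ν j → ∀ i → χ (j ≡ᵇ i) ≤ ν i
χ≡ᵇ≤ {ν} {j} occurs i with j ≡ᵇ i in eq
... | false = z≤n
... | true  = subst (λ i → 1 ≤ ν i) (≡ᵇ-true⇒≡ eq) occurs

agree-∷ : (n : ℕ) {j : ℕ} → j < n → (t : List ℕ) (ν : ℕ → ℕ) →
          agreeᵇ n (profile (suc j ∷ t)) ν ≡ (1 ≤ᵇ ν j) ∧ agreeᵇ n (profile t) (removeOne ν j)
agree-∷ n {j} j<n t ν = T-ext to from
  where
  to : T (agreeᵇ n (profile (suc j ∷ t)) ν) → T ((1 ≤ᵇ ν j) ∧ agreeᵇ n (profile t) (removeOne ν j))
  to h = T-∧⁺ (≤⇒≤ᵇ occurs) (allN⁺ n λ {i} i<n → ≡⇒≡ᵇ _ _ (sym (begin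
      ν i ∸ χ (j ≡ᵇ i)                           ≡⟨ cong (_∸ χ (j ≡ᵇ i)) (sym (agrees i<n)) ⟩
      profile (suc j ∷ t) i ∸ χ (j ≡ᵇ i)         ≡⟨ cong (_∸ χ (j ≡ᵇ i)) (profile-∷ j t i) ⟩
      χ (j ≡ᵇ i) + profile t i ∸ χ (j ≡ᵇ i)      ≡⟨ m+n∸m≡n (χ (j ≡ᵇ i)) _ ⟩
      profile t i                                ∎)))
    where
    agrees : ∀ {i} → i < n → profile (suc j ∷ t) i ≡ ν i
    agrees i<n = ≡ᵇ⇒≡ _ _ (allN⁻ n h i<n)
    occurs : 1 ≤ ν j
    occurs = subst (1 ≤_) (trans (sym (profile-∷ j t j)) (agrees j<n))
                   (subst (λ c → 1 ≤ c + profile t j) (sym (χ-≡ᵇ-refl j)) (s≤s z≤n))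
  from : T ((1 ≤ᵇ ν j) ∧ agreeᵇ n (profile t) (removeOne ν j)) → T (agreeᵇ n (profile (suc j ∷ t)) ν)
  from h = allN⁺ n λ {i} i<n → ≡⇒≡ᵇ _ _ (begin
      profile (suc j ∷ t) i              ≡⟨ profile-∷ j t i ⟩
      χ (j ≡ᵇ i) + profile t i           ≡⟨ cong (χ (j ≡ᵇ i) +_) (≡ᵇ⇒≡ _ _ (allN⁻ n rest i<n)) ⟩
      χ (j ≡ᵇ i) + (ν i ∸ χ (j ≡ᵇ i))    ≡⟨ m+[n∸m]≡n (χ≡ᵇ≤ {ν} (≤ᵇ⇒≤ 1 (ν j) occurs) i) ⟩
      ν i                                ∎)
    where
    occurs : T (1 ≤ᵇ ν j)
    occurs = proj₁ (T-∧⁻ h)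
    rest : T (agreeᵇ n (profile t) (removeOne ν j))
    rest = proj₂ (T-∧⁻ h)

wordsWithProfile-suc : (n m : ℕ) (ν : ℕ → ℕ) →
  wordsWithProfile n (suc m) ν ≡ ∑< n (λ j → χ (1 ≤ᵇ ν j) * wordsWithProfile n m (removeOne ν j))
wordsWithProfile-suc n m ν = begin
  wordsWithProfile n (suc m) ν
    ≡⟨ count≡∑χ _ (tuplesOver (range1 n) (suc m)) ⟩
  ∑[ t ∈ tuplesOver (range1 n) (suc m) ] χ (agreeᵇ n (profile t) ν)
    ≡⟨ ∑-tuplesOver-suc (range1 n) m _ ⟩
  ∑[ a ∈ range1 n ] ∑[ t ∈ words ] χ (agreeᵇ n (profile (a ∷ t)) ν)
    ≡⟨ ∑-applyUpTo suc n _ ⟩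
  ∑< n (λ j → ∑[ t ∈ words ] χ (agreeᵇ n (profile (suc j ∷ t)) ν))
    ≡⟨ ∑<-cong n first-letter ⟩
  ∑< n (λ j → χ (1 ≤ᵇ ν j) * wordsWithProfile n m (removeOne ν j))
    ∎
  where
  words : List (List ℕ)
  words = tuplesOver (range1 n) m
  first-letter : ∀ {j} → j < n →
    ∑[ t ∈ words ] χ (agreeᵇ n (profile (suc j ∷ t)) ν) ≡ χ (1 ≤ᵇ ν j) * wordsWithProfile n m (removeOne ν j)
  first-letter {j} j<n = begin
    ∑[ t ∈ words ] χ (agreeᵇ n (profile (suc j ∷ t)) ν)
      ≡⟨ ∑-cong words (λ t → cong χ (agree-∷ n j<n t ν)) ⟩
    ∑[ t ∈ words ] χ ((1 ≤ᵇ ν j) ∧ agreeᵇ n (profile t) (removeOne ν j))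
      ≡⟨ ∑-χ∧ words (1 ≤ᵇ ν j) _ ⟩
    χ (1 ≤ᵇ ν j) * ∑[ t ∈ words ] χ (agreeᵇ n (profile t) (removeOne ν j))
      ≡⟨ cong (χ (1 ≤ᵇ ν j) *_) (count≡∑χ _ words) ⟨
    χ (1 ≤ᵇ ν j) * wordsWithProfile n m (removeOne ν j)
      ∎

module _ (n : ℕ) {ν : ℕ → ℕ} {j : ℕ} (j<n : j < n) where

  private
    removeOne-off-j : ∀ {f : ℕ → ℕ} {i} → i < n → i ≢ j → f (removeOne ν j i) ≡ f (ν i)
    removeOne-off-j {f} {i} _ i≢j = cong (λ c → f (ν i ∸ c)) (χ-≡ᵇ-≢ (i≢j ∘ sym))
    removeOne-at-j : removeOne ν j j ≡ ν j ∸ 1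
    removeOne-at-j = cong (ν j ∸_) (χ-≡ᵇ-refl j)

  ∑<-removeOne : 1 ≤ ν j → ∑< n ν ≡ suc (∑< n (removeOne ν j))
  ∑<-removeOne occurs =
    undo (ν j) occurs (trans (∑<-update n j<n (removeOne-off-j {λ v → v})) (cong (∑< n ν +_) removeOne-at-j))
    where
    undo : ∀ v {x y} → 1 ≤ v → x + v ≡ y + (v ∸ 1) → y ≡ suc x
    undo (suc r) {x} {y} _ eq = sym (+-cancelʳ-≡ r (suc x) y (trans (sym (+-suc x r)) eq))

  ∏<-removeOne! : 1 ≤ ν j → ∏< n (λ i → ν i !) ≡ ν j * ∏< n (λ i → removeOne ν j i !)
  ∏<-removeOne! occurs =
    undo (ν j) occurs (trans (∏<-update n j<n (removeOne-off-j {_!}))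
                             (cong (λ c → ∏< n (λ i → ν i !) * c !) removeOne-at-j))
    where
    undo : ∀ v {x y} → 1 ≤ v → x * v ! ≡ y * (v ∸ 1) ! → y ≡ v * x
    undo (suc r) {x} {y} _ eq = sym (*-cancelʳ-≡ (suc r * x) y (r !) {{r !≢0}}
                                  (trans (cong (_* r !) (*-comm (suc r) x)) (trans (*-assoc x (suc r) (r !)) eq)))

multinomial : (n m : ℕ) (ν : ℕ → ℕ) → ∑< n ν ≡ m → wordsWithProfile n m ν * ∏< n (λ i → ν i !) ≡ m !
multinomial n zero ν ∑≡0 = cong₂ _*_ only-empty-word (∏<-one n (λ i<n → cong _! (∑<≡0⇒≡0 n ∑≡0 i<n)))
  where
  only-empty-word : wordsWithProfile n 0 ν ≡ 1
  only-empty-word = trans (count≡∑χ (λ t → agreeᵇ n (profile t) ν) ([] ∷ []))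
    (cong (λ b → χ b + 0) (T⇒≡true (allN⁺ n λ i<n → ≡⇒≡ᵇ 0 _ (sym (∑<≡0⇒≡0 n ∑≡0 i<n)))))
multinomial n (suc m) ν ∑≡m+1 = begin
  wordsWithProfile n (suc m) ν * ∏ν!
    ≡⟨ cong (_* ∏ν!) (wordsWithProfile-suc n m ν) ⟩
  ∑< n (λ j → χ (1 ≤ᵇ ν j) * wordsWithProfile n m (removeOne ν j)) * ∏ν!
    ≡⟨ ∑<-*ʳ n _ ∏ν! ⟩
  ∑< n (λ j → χ (1 ≤ᵇ ν j) * wordsWithProfile n m (removeOne ν j) * ∏ν!)
    ≡⟨ ∑<-cong n first-letter ⟩
  ∑< n (λ j → ν j * m !)
    ≡⟨ ∑<-*ʳ n ν (m !) ⟨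
  ∑< n ν * m !
    ≡⟨ cong (_* m !) ∑≡m+1 ⟩
  suc m * m !
    ∎
  where
  ∏ν! : ℕ
  ∏ν! = ∏< n (λ i → ν i !)
  first-letter : ∀ {j} → j < n → χ (1 ≤ᵇ ν j) * wordsWithProfile n m (removeOne ν j) * ∏ν! ≡ ν j * m !
  first-letter {j} j<n with ν j in νj
  ... | zero  = refl
  ... | suc r = begin
    (wordsWithProfile n m ν′ + 0) * ∏ν!
      ≡⟨ cong₂ _*_ (+-identityʳ (wordsWithProfile n m ν′)) (∏<-removeOne! n {ν} j<n occurs) ⟩
    wordsWithProfile n m ν′ * (ν j * ∏< n (λ i → ν′ i !))
      ≡⟨ x∙yz≈y∙xz (wordsWithProfile n m ν′) (ν j) _ ⟩
    ν j * (wordsWithProfile n m ν′ * ∏< n (λ i → ν′ i !))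
      ≡⟨ cong₂ _*_ νj (multinomial n m ν′ ∑ν′) ⟩
    suc r * m !
      ∎
    where
    ν′ : ℕ → ℕ
    ν′ = removeOne ν j
    occurs : 1 ≤ ν j
    occurs = subst (1 ≤_) (sym νj) (s≤s z≤n)
    ∑ν′ : ∑< n ν′ ≡ m
    ∑ν′ = suc-injective (trans (sym (∑<-removeOne n {ν} j<n occurs)) ∑≡m+1)

ShapeFacts : ℕ → ℕ → (ℕ → ℕ) → Set
ShapeFacts n k σ = ∑< n σ ≡ n × ∏< n (λ i → σ i !) ≡ 2 ^ (n ∸ k) × k ≤ n

shapes-facts : (n k : ℕ) → All (ShapeFacts n k) (shapes n k)
pairShapes-facts : (n k : ℕ) → All (ShapeFacts (suc n) (suc k)) (pairShapes n k)
shapes-facts zero    zero    = (refl , refl , z≤n) ∷ []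
shapes-facts zero    (suc k) = []
shapes-facts (suc n) zero    = []
shapes-facts (suc n) (suc k) = ++⁺ (map⁺ (All.map single (shapes-facts n k))) (pairShapes-facts n k)
  where
  single : ∀ {σ} → ShapeFacts n k σ → ShapeFacts (suc n) (suc k) (1 ◂ σ)
  single (∑σ , ∏σ , k≤n) = cong suc ∑σ , trans (+-identityʳ _) ∏σ , s≤s k≤n
pairShapes-facts zero    k = []
pairShapes-facts (suc n) k = map⁺ (All.map pair (shapes-facts n k))
  where
  pair : ∀ {σ} → ShapeFacts n k σ → ShapeFacts (suc (suc n)) (suc k) (2 ◂ 0 ◂ σ)
  pair {σ} (∑σ , ∏σ , k≤n) =
    cong (2 +_) ∑σ ,
    trans (cong (2 *_) (trans (+-identityʳ _) ∏σ)) (cong (2 ^_) (sym (+-∸-assoc 1 k≤n))) ,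
    s≤s (m≤n⇒m≤1+n k≤n)

fUFR-closed : (n k : ℕ) → fUFR n k * 2 ^ (n ∸ k) ≡ length (shapes n k) * n !
fUFR-closed n k = begin
  fUFR n k * 2 ^ (n ∸ k)
    ≡⟨ cong (_* 2 ^ (n ∸ k)) (fUFR≡∑wordsWithProfile n k) ⟩
  ∑[ σ ∈ shapes n k ] wordsWithProfile n n σ * 2 ^ (n ∸ k)
    ≡⟨ ∑-*ʳ (shapes n k) _ (2 ^ (n ∸ k)) ⟩
  ∑[ σ ∈ shapes n k ] (wordsWithProfile n n σ * 2 ^ (n ∸ k))
    ≡⟨ ∑-cong-All (λ {σ} (∑σ , ∏σ , _) → trans (cong (wordsWithProfile n n σ *_) (sym ∏σ)) (multinomial n n σ ∑σ))
              (shapes-facts n k) ⟩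
  ∑[ σ ∈ shapes n k ] (n !)
    ≡⟨ ∑-const (shapes n k) (n !) ⟩
  length (shapes n k) * n !
    ∎

-- Tilings by squares and dominoes

+suc+suc : (a b : ℕ) → a + (suc b + suc b) ≡ suc (suc a + (b + b))
+suc+suc a b = begin
  a + suc (b + suc b)     ≡⟨ +-suc a _ ⟩
  suc (a + (b + suc b))   ≡⟨ cong (λ m → suc (a + m)) (+-suc b b) ⟩
  suc (a + suc (b + b))   ≡⟨ cong suc (+-suc a (b + b)) ⟩
  suc (suc a + (b + b))   ∎

-- tilings of a strip of n cells by k squares and dominoes, a domino followed by m further cells
-- weighing w m; w = 1 counts shapes, and w = suc counts partitions into blocks of size ≤ 2, where
-- the first of m + 2 elements can be paired with any of the m + 1 others
module _ (w : ℕ → ℕ) where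

  tilings dominoFirst : ℕ → ℕ → ℕ
  tilings zero    zero    = 1
  tilings zero    (suc k) = 0
  tilings (suc n) zero    = 0
  tilings (suc n) (suc k) = tilings n k + dominoFirst n k
  dominoFirst zero    k = 0
  dominoFirst (suc n) k = w n * tilings n k

  tilings-vanish-< : (n k : ℕ) → n < k → tilings n k ≡ 0
  tilings-vanish-< zero    (suc k) _ = refl
  tilings-vanish-< (suc n) (suc k) (s<s n<k) = cong₂ _+_ (tilings-vanish-< n k n<k) (domino n n<k)
    where
    domino : ∀ m → m < k → dominoFirst m k ≡ 0
    domino zero    _   = refl
    domino (suc m) m<k = trans (cong (w m *_) (tilings-vanish-< m k (<-trans (n<1+n m) m<k))) (*-zeroʳ (w m))

  tilings-vanish-> : (n k : ℕ) → k + k < n → tilings n k ≡ 0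
  tilings-vanish-> (suc n) zero    _ = refl
  tilings-vanish-> (suc n) (suc k) (s<s 2k+1<n) =
    cong₂ _+_ (tilings-vanish-> n k (<-trans (n<1+n _) 2k+2≤n)) (domino n 2k+2≤n)
    where
    2k+2≤n : suc (k + k) < n
    2k+2≤n = subst (_< n) (+-suc k k) 2k+1<n
    domino : ∀ m → suc (k + k) < m → dominoFirst m k ≡ 0
    domino (suc m) (s<s 2k+1<m) = trans (cong (w m *_) (tilings-vanish-> m k 2k+1<m)) (*-zeroʳ (w m))

  tilings-squares : (m : ℕ) → tilings (suc m) (suc m) ≡ tilings m m
  tilings-squares zero    = refl
  tilings-squares (suc m) = trans (cong (λ d → tilings (suc m) (suc m) + w m * d) (tilings-vanish-< m (suc m) (n<1+n m)))
                                  (trans (cong (tilings (suc m) (suc m) +_) (*-zeroʳ (w m))) (+-identityʳ _))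

  tilings-dominoes : (b : ℕ) → tilings (suc b + suc b) (suc b) ≡ w (b + b) * tilings (b + b) b
  tilings-dominoes b = begin
    tilings (b + suc b) b + dominoFirst (b + suc b) b
      ≡⟨ cong₂ _+_ (tilings-vanish-> (b + suc b) b (subst (b + b <_) (sym (+-suc b b)) (n<1+n _)))
                   (cong (λ m → dominoFirst m b) (+-suc b b)) ⟩
    w (b + b) * tilings (b + b) b
      ∎

  tilings-pascal : (a b : ℕ) → tilings (suc a + (suc b + suc b)) (suc a + suc b) ≡
    tilings (a + (suc b + suc b)) (a + suc b) + w (suc a + (b + b)) * tilings (suc a + (b + b)) (suc a + b)
  tilings-pascal a b = cong (tilings (a + (suc b + suc b)) (a + suc b) +_) (cong₂ dominoFirst (+suc+suc a b) (+-suc a b))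

binomial-tilings : (a b : ℕ) → tilings (λ _ → 1) (a + (b + b)) (a + b) * (a ! * b !) ≡ (a + b) !
binomial-tilings zero    zero    = refl
binomial-tilings (suc a) zero    = begin
  tilings (λ _ → 1) (suc a + 0) (suc a + 0) * (suc a * a ! * 1)
    ≡⟨ cong (_* (suc a * a ! * 1)) (tilings-squares (λ _ → 1) (a + 0)) ⟩
  tilings (λ _ → 1) (a + 0) (a + 0) * (suc a * a ! * 1)
    ≡⟨ lemma (tilings (λ _ → 1) (a + 0) (a + 0)) a (a !) ⟩
  suc a * (tilings (λ _ → 1) (a + 0) (a + 0) * (a ! * 1))
    ≡⟨ cong (suc a *_) (binomial-tilings a zero) ⟩
  suc a * (a + 0) !
    ≡⟨ cong (λ x → suc x * (a + 0) !) (+-identityʳ a) ⟨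
  (suc a + 0) !
    ∎
  where
  lemma : ∀ t a A → t * (suc a * A * 1) ≡ suc a * (t * (A * 1))
  lemma = solve-∀
binomial-tilings zero    (suc b) = begin
  tilings (λ _ → 1) (suc b + suc b) (suc b) * (1 * (suc b * b !))
    ≡⟨ cong (_* (1 * (suc b * b !))) (tilings-dominoes (λ _ → 1) b) ⟩
  1 * tilings (λ _ → 1) (b + b) b * (1 * (suc b * b !))
    ≡⟨ lemma (tilings (λ _ → 1) (b + b) b) b (b !) ⟩
  suc b * (tilings (λ _ → 1) (b + b) b * (1 * b !))
    ≡⟨ cong (suc b *_) (binomial-tilings zero b) ⟩
  suc b * b !
    ∎
  where
  lemma : ∀ t b B → 1 * t * (1 * (suc b * B)) ≡ suc b * (t * (1 * B))
  lemma = solve-∀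
binomial-tilings (suc a) (suc b) = begin
  tilings (λ _ → 1) (suc a + (suc b + suc b)) (suc a + suc b) * (suc a ! * suc b !)
    ≡⟨ cong (_* (suc a ! * suc b !)) (tilings-pascal (λ _ → 1) a b) ⟩
  (t₁ + 1 * t₂) * ((suc a * a !) * (suc b * b !))
    ≡⟨ lemma t₁ t₂ a (a !) b (b !) ⟩
  suc a * (t₁ * (a ! * suc b !)) + suc b * (t₂ * (suc a ! * b !))
    ≡⟨ cong₂ (λ x y → suc a * x + suc b * y) (binomial-tilings a (suc b))
             (trans (binomial-tilings (suc a) b) (cong _! (sym (+-suc a b)))) ⟩
  suc a * (a + suc b) ! + suc b * (a + suc b) !
    ≡⟨ *-distribʳ-+ ((a + suc b) !) (suc a) (suc b) ⟨
  (suc a + suc b) !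
    ∎
  where
  t₁ t₂ : ℕ
  t₁ = tilings (λ _ → 1) (a + (suc b + suc b)) (a + suc b)
  t₂ = tilings (λ _ → 1) (suc a + (b + b)) (suc a + b)
  lemma : ∀ t₁ t₂ a A b B → (t₁ + 1 * t₂) * ((suc a * A) * (suc b * B)) ≡
                            suc a * (t₁ * (A * (suc b * B))) + suc b * (t₂ * ((suc a * A) * B))
  lemma = solve-∀

pairing-tilings : (a b : ℕ) → tilings suc (a + (b + b)) (a + b) * (2 ^ b * (a ! * b !)) ≡ (a + (b + b)) !
pairing-tilings zero    zero    = refl
pairing-tilings (suc a) zero    = begin
  tilings suc (suc a + 0) (suc a + 0) * (1 * (suc a * a ! * 1))
    ≡⟨ cong (_* (1 * (suc a * a ! * 1))) (tilings-squares suc (a + 0)) ⟩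
  tilings suc (a + 0) (a + 0) * (1 * (suc a * a ! * 1))
    ≡⟨ lemma (tilings suc (a + 0) (a + 0)) a (a !) ⟩
  suc a * (tilings suc (a + 0) (a + 0) * (1 * (a ! * 1)))
    ≡⟨ cong (suc a *_) (pairing-tilings a zero) ⟩
  suc a * (a + 0) !
    ≡⟨ cong (λ x → suc x * (a + 0) !) (+-identityʳ a) ⟨
  (suc a + 0) !
    ∎
  where
  lemma : ∀ t a A → t * (1 * (suc a * A * 1)) ≡ suc a * (t * (1 * (A * 1)))
  lemma = solve-∀
pairing-tilings zero    (suc b) = begin
  tilings suc (suc b + suc b) (suc b) * (2 * 2 ^ b * (1 * (suc b * b !)))
    ≡⟨ cong (_* (2 * 2 ^ b * (1 * (suc b * b !)))) (tilings-dominoes suc b) ⟩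
  suc (b + b) * t * (2 * 2 ^ b * (1 * (suc b * b !)))
    ≡⟨ lemma t b (2 ^ b) (b !) ⟩
  suc (b + b) * (2 * suc b) * (t * (2 ^ b * (1 * b !)))
    ≡⟨ cong (suc (b + b) * (2 * suc b) *_) (pairing-tilings zero b) ⟩
  suc (b + b) * (2 * suc b) * (b + b) !
    ≡⟨ lemma′ b ((b + b) !) ⟩
  suc (suc (b + b)) * suc (b + b) !
    ≡⟨ cong (λ m → suc m * m !) (+-suc b b) ⟨
  (suc b + suc b) !
    ∎
  where
  t : ℕ
  t = tilings suc (b + b) b
  lemma : ∀ t b P B → suc (b + b) * t * (2 * P * (1 * (suc b * B))) ≡ suc (b + b) * (2 * suc b) * (t * (P * (1 * B)))
  lemma = solve-∀
  lemma′ : ∀ b F → suc (b + b) * (2 * suc b) * F ≡ suc (suc (b + b)) * (suc (b + b) * F)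
  lemma′ = solve-∀
pairing-tilings (suc a) (suc b) = begin
  tilings suc (suc a + (suc b + suc b)) (suc a + suc b) * (2 * 2 ^ b * (suc a ! * suc b !))
    ≡⟨ cong (_* (2 * 2 ^ b * (suc a ! * suc b !))) (tilings-pascal suc a b) ⟩
  (t₁ + suc m * t₂) * (2 * 2 ^ b * ((suc a * a !) * (suc b * b !)))
    ≡⟨ lemma t₁ t₂ (2 ^ b) a (a !) b (b !) m ⟩
  suc a * (t₁ * (2 ^ suc b * (a ! * suc b !))) + suc m * (2 * suc b) * (t₂ * (2 ^ b * (suc a ! * b !)))
    ≡⟨ cong₂ (λ x y → suc a * x + suc m * (2 * suc b) * y)
             (trans (pairing-tilings a (suc b)) (cong _! (+suc+suc a b))) (pairing-tilings (suc a) b) ⟩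
  suc a * suc m ! + suc m * (2 * suc b) * m !
    ≡⟨ lemma′ a b (m !) ⟩
  suc (suc m) * suc m !
    ≡⟨ cong (λ n → suc n !) (+suc+suc a b) ⟨
  (suc a + (suc b + suc b)) !
    ∎
  where
  m t₁ t₂ : ℕ
  m = suc a + (b + b)
  t₁ = tilings suc (a + (suc b + suc b)) (a + suc b)
  t₂ = tilings suc m (suc a + b)
  lemma : ∀ t₁ t₂ P a A b B m → (t₁ + suc m * t₂) * (2 * P * ((suc a * A) * (suc b * B))) ≡
          suc a * (t₁ * (2 * P * (A * (suc b * B)))) + suc m * (2 * suc b) * (t₂ * (P * ((suc a * A) * B)))
  lemma = solve-∀
  lemma′ : ∀ a b F → suc a * (suc (suc a + (b + b)) * F) + suc (suc a + (b + b)) * (2 * suc b) * F ≡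
                     suc (suc (suc a + (b + b))) * (suc (suc a + (b + b)) * F)
  lemma′ = solve-∀

length-shapes : (n k : ℕ) → length (shapes n k) ≡ tilings (λ _ → 1) n k
length-pairShapes : (n k : ℕ) → length (pairShapes n k) ≡ dominoFirst (λ _ → 1) n k
length-shapes zero    zero    = refl
length-shapes zero    (suc k) = refl
length-shapes (suc n) zero    = refl
length-shapes (suc n) (suc k) =
  trans (length-++ (map (1 ◂_) (shapes n k)))
        (cong₂ _+_ (trans (length-map (1 ◂_) (shapes n k)) (length-shapes n k)) (length-pairShapes n k))
length-pairShapes zero    k = refl
length-pairShapes (suc n) k =
  trans (length-map _ (shapes n k)) (trans (length-shapes n k) (sym (+-identityʳ _)))

-- Set partitions into blocks of size at most 2

smallBlockᵇ : List Bool → Bool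
smallBlockᵇ B = (1 ≤ᵇ card B) ∧ (card B ≤ᵇ 2)

-- subsets of [0, n) are Bool lists of length n (as in the definition of S≤2) or predicates on ℕ
_⊆ᵇ[_]_ : List Bool → ℕ → (ℕ → Bool) → Bool
B ⊆ᵇ[ n ] U = allN n (λ i → not (memᵇ B i) ∨ U i)

_∖_ : (ℕ → Bool) → List Bool → ℕ → Bool
(U ∖ B) i = U i ∧ not (memᵇ B i)

size : ℕ → (ℕ → Bool) → ℕ
size n U = ∑< n (χ ∘ U)

emptyᵇ : ℕ → (ℕ → Bool) → Bool
emptyᵇ n U = allN n (not ∘ U)

firstBlockᵇ : ℕ → (ℕ → Bool) → ℕ → List Bool → Bool
firstBlockᵇ n U b B = smallBlockᵇ B ∧ (b ≤ᵇ minElem B) ∧ (B ⊆ᵇ[ n ] U)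

partitionsᵇ : ℕ → (ℕ → Bool) → ℕ → List (List Bool) → Bool
partitionsᵇ n U b []      = emptyᵇ n U
partitionsᵇ n U b (B ∷ P) = firstBlockᵇ n U b B ∧ partitionsᵇ n (U ∖ B) (suc (minElem B)) P

coversᵇ : ℕ → List (List Bool) → (ℕ → Bool) → Bool
coversᵇ n P U = allN n (λ i → coverCount P i ≡ᵇ χ (U i))

startsFromᵇ : ℕ → List (List Bool) → Bool
startsFromᵇ b []      = true
startsFromᵇ b (C ∷ _) = b ≤ᵇ minElem C

coversᵇ-∷ : (n : ℕ) (B : List Bool) (P : List (List Bool)) (U : ℕ → Bool) →
            coversᵇ n (B ∷ P) U ≡ (B ⊆ᵇ[ n ] U) ∧ coversᵇ n P (U ∖ B)
coversᵇ-∷ n B P U =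
  trans (allN-cong n λ {i} _ → trans (cong (_≡ᵇ χ (U i)) (count-∷ (λ C → memᵇ C i) B P)) (split (memᵇ B i) (U i)))
        (allN-∧ n _ _)
  where
  split : ∀ m u {c} → (χ m + c ≡ᵇ χ u) ≡ (not m ∨ u) ∧ (c ≡ᵇ χ (u ∧ not m))
  split true  true  = refl
  split true  false = refl
  split false true  = refl
  split false false = refl

sortedByMin-∷ : (B : List Bool) (P : List (List Bool)) →
                sortedByMinᵇ (B ∷ P) ≡ startsFromᵇ (suc (minElem B)) P ∧ sortedByMinᵇ P
sortedByMin-∷ B []      = refl
sortedByMin-∷ B (C ∷ P) = refl

partitionsᵇ-spec : (n : ℕ) (U : ℕ → Bool) (b : ℕ) (P : List (List Bool)) →
  all smallBlockᵇ P ∧ coversᵇ n P U ∧ sortedByMinᵇ P ∧ startsFromᵇ b P ≡ partitionsᵇ n U b P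
partitionsᵇ-spec n U b [] = trans (∧-identityʳ _) (allN-cong n λ {i} _ → 0≡ᵇχ (U i))
  where
  0≡ᵇχ : ∀ u → (0 ≡ᵇ χ u) ≡ not u
  0≡ᵇχ true  = refl
  0≡ᵇχ false = refl
partitionsᵇ-spec n U b (B ∷ P) = begin
  (small ∧ all smallBlockᵇ P) ∧ coversᵇ n (B ∷ P) U ∧ sortedByMinᵇ (B ∷ P) ∧ above
    ≡⟨ cong₂ (λ c s → (small ∧ all smallBlockᵇ P) ∧ c ∧ s ∧ above) (coversᵇ-∷ n B P U) (sortedByMin-∷ B P) ⟩
  (small ∧ all smallBlockᵇ P) ∧ (sub ∧ coversᵇ n P U′) ∧ (startsFromᵇ b′ P ∧ sortedByMinᵇ P) ∧ above
    ≡⟨ ∧-rearrange small (all smallBlockᵇ P) sub (coversᵇ n P U′) (startsFromᵇ b′ P) (sortedByMinᵇ P) above ⟩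
  firstBlockᵇ n U b B ∧ (all smallBlockᵇ P ∧ coversᵇ n P U′ ∧ sortedByMinᵇ P ∧ startsFromᵇ b′ P)
    ≡⟨ cong (firstBlockᵇ n U b B ∧_) (partitionsᵇ-spec n U′ b′ P) ⟩
  partitionsᵇ n U b (B ∷ P)
    ∎
  where
  small above sub : Bool
  small = smallBlockᵇ B
  above = b ≤ᵇ minElem B
  sub = B ⊆ᵇ[ n ] U
  U′ : ℕ → Bool
  U′ = U ∖ B
  b′ : ℕ
  b′ = suc (minElem B)
  ∧-rearrange : ∀ o os c cs h s l → (o ∧ os) ∧ (c ∧ cs) ∧ (h ∧ s) ∧ l ≡ (o ∧ l ∧ c) ∧ (os ∧ cs ∧ s ∧ h)
  ∧-rearrange = ∧-Solver.solve 7 (λ o os c cs h s l → (o ⊕ os) ⊕ (c ⊕ cs) ⊕ (h ⊕ s) ⊕ l ⊜ (o ⊕ l ⊕ c) ⊕ (os ⊕ cs ⊕ s ⊕ h))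
                                 refl
    where open ∧-Solver using (_⊕_; _⊜_)

partitionCount : ℕ → (ℕ → Bool) → ℕ → ℕ → ℕ
partitionCount n U b j = countᵇ (partitionsᵇ n U b) (tuplesOver (allSubsets n) j)

S≤2≡partitionCount : (n k : ℕ) → S≤2 n k ≡ partitionCount n (λ _ → true) 0 k
S≤2≡partitionCount n k = count-cong (tuplesOver (allSubsets n) k) λ P → begin
  all smallBlockᵇ P ∧ all (λ i → coverCount P i ≡ᵇ 1) (upTo n) ∧ sortedByMinᵇ P
    ≡⟨ cong₂ (λ c s → all smallBlockᵇ P ∧ c ∧ s) (all-applyUpTo (λ i → i) n _)
             (trans (sym (∧-identityʳ _)) (cong (sortedByMinᵇ P ∧_) (startsFrom0 P))) ⟩
  all smallBlockᵇ P ∧ coversᵇ n P (λ _ → true) ∧ sortedByMinᵇ P ∧ startsFromᵇ 0 P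
    ≡⟨ partitionsᵇ-spec n (λ _ → true) 0 P ⟩
  partitionsᵇ n (λ _ → true) 0 P
    ∎
  where
  startsFrom0 : ∀ P → true ≡ startsFromᵇ 0 P
  startsFrom0 []      = refl
  startsFrom0 (_ ∷ _) = refl

partitionCount-suc : (n : ℕ) (U : ℕ → Bool) (b j : ℕ) → partitionCount n U b (suc j) ≡
  ∑[ B ∈ allSubsets n ] (χ (firstBlockᵇ n U b B) * partitionCount n (U ∖ B) (suc (minElem B)) j)
partitionCount-suc n U b j = begin
  partitionCount n U b (suc j)
    ≡⟨ count≡∑χ _ (tuplesOver (allSubsets n) (suc j)) ⟩
  ∑[ P ∈ tuplesOver (allSubsets n) (suc j) ] χ (partitionsᵇ n U b P)
    ≡⟨ ∑-tuplesOver-suc (allSubsets n) j _ ⟩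
  ∑[ B ∈ allSubsets n ] ∑[ P ∈ rest ] χ (firstBlockᵇ n U b B ∧ partitionsᵇ n (U ∖ B) (suc (minElem B)) P)
    ≡⟨ ∑-cong (allSubsets n) (λ B → trans (∑-χ∧ rest (firstBlockᵇ n U b B) _)
         (cong (χ (firstBlockᵇ n U b B) *_) (sym (count≡∑χ (partitionsᵇ n (U ∖ B) (suc (minElem B))) rest)))) ⟩
  ∑[ B ∈ allSubsets n ] (χ (firstBlockᵇ n U b B) * partitionCount n (U ∖ B) (suc (minElem B)) j)
    ∎
  where
  rest : List (List (List Bool))
  rest = tuplesOver (allSubsets n) j

minElem-≤ : (B : List Bool) {i : ℕ} → T (memᵇ B i) → minElem B ≤ i
minElem-≤ (true  ∷ B)         _ = z≤n
minElem-≤ (false ∷ B) {suc i} m = s≤s (minElem-≤ B m)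

minElem-mem : (B : List Bool) → 1 ≤ card B → T (memᵇ B (minElem B))
minElem-mem (true  ∷ B) _ = tt
minElem-mem (false ∷ B) c = minElem-mem B c

memᵇ-< : (B : List Bool) {i : ℕ} → T (memᵇ B i) → i < length B
memᵇ-< (_ ∷ B) {zero}  _ = z<s
memᵇ-< (_ ∷ B) {suc i} m = s<s (memᵇ-< B m)

⊆ᵇ-mem : (n : ℕ) (B : List Bool) {U : ℕ → Bool} → T (B ⊆ᵇ[ n ] U) → ∀ {i} → i < n → T (memᵇ B i) → T (U i)
⊆ᵇ-mem n B sub {i} i<n mem with memᵇ B i | allN⁻ n sub i<n
... | true | ui = ui

firstBlock-parts : (n : ℕ) {U : ℕ → Bool} {b : ℕ} (B : List Bool) → T (firstBlockᵇ n U b B) →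
                   T (smallBlockᵇ B) × b ≤ minElem B × T (B ⊆ᵇ[ n ] U)
firstBlock-parts n {b = b} B fb =
  let (small , rest) = T-∧⁻ fb
      (b≤min , sub) = T-∧⁻ rest
  in  small , ≤ᵇ⇒≤ b (minElem B) b≤min , sub

partitionCount-low : (n : ℕ) {U : ℕ → Bool} {b i : ℕ} → i < n → T (U i) → i < b →
                     ∀ j → partitionCount n U b j ≡ 0
partitionCount-low n {U} {b} i<n ui i<b zero =
  trans (count≡∑χ (partitionsᵇ n U b) ([] ∷ [])) (cong (λ e → χ e + 0) (¬T⇒≡false nonempty))
  where
  nonempty : ¬ T (emptyᵇ n U)
  nonempty empty = subst T (cong not (T⇒≡true ui)) (allN⁻ n empty i<n)
partitionCount-low n {U} {b} {i} i<n ui i<b (suc j) =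
  trans (partitionCount-suc n U b j) (trans (∑-cong (allSubsets n) vanishes) (∑-zero (allSubsets n)))
  where
  vanishes : ∀ B → χ (firstBlockᵇ n U b B) * partitionCount n (U ∖ B) (suc (minElem B)) j ≡ 0
  vanishes B with firstBlockᵇ n U b B in fb
  ... | false = refl
  ... | true  = trans (+-identityʳ _) (partitionCount-low n i<n still-there (≤-trans i<b (m≤n⇒m≤1+n b≤min)) j)
    where
    b≤min : b ≤ minElem B
    b≤min = proj₁ (proj₂ (firstBlock-parts n B (subst T (sym fb) tt)))
    still-there : T ((U ∖ B) i)
    still-there with memᵇ B i in mem
    ... | true  = contradiction (≤-trans b≤min (minElem-≤ B (subst T (sym mem) tt))) (<⇒≱ i<b)
    ... | false = subst (λ u → T (u ∧ true)) (sym (T⇒≡true ui)) tt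

-- B contains the least element of U
leadsᵇ : (ℕ → Bool) → List Bool → Bool
leadsᵇ U []      = false
leadsᵇ U (x ∷ B) = if U 0 then x else leadsᵇ (U ∘ suc) B

leads-above : {n : ℕ} {U : ℕ → Bool} (B : List Bool) → length B ≡ n → T (B ⊆ᵇ[ n ] U) → T (leadsᵇ U B) →
              ∀ {i} → i < n → T ((U ∖ B) i) → minElem B < i
leads-above (true  ∷ B) _ _ _ {suc i} _ _ = z<s
leads-above {U = U} (true  ∷ B) _ _ _ {zero} _ rest = ⊥-elim (subst T (∧-zeroʳ (U 0)) rest)
leads-above {U = U} (false ∷ B) _ _ leads {zero} _ rest with U 0
... | true  = ⊥-elim leads
... | false = ⊥-elim rest
leads-above {suc n} {U} (false ∷ B) len sub leads {suc i} i<n rest with U 0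
... | true  = ⊥-elim leads
... | false = s<s (leads-above B (suc-injective len) sub leads (≤-pred i<n) rest)

leads-or-below : {n : ℕ} {U : ℕ → Bool} (B : List Bool) → length B ≡ n → T (B ⊆ᵇ[ n ] U) → 1 ≤ card B →
                 ¬ T (leadsᵇ U B) → ∃[ i ] i < n × T ((U ∖ B) i) × i ≤ minElem B
leads-or-below {suc n} {U} (true ∷ B) _ sub _ ¬leads with U 0
... | true  = ⊥-elim (¬leads tt)
... | false = ⊥-elim sub
leads-or-below {suc n} {U} (false ∷ B) len sub nonempty ¬leads with U 0 in u0
... | true  = 0 , z<s , subst (λ u → T (u ∧ true)) (sym u0) tt , z≤n
... | false = let (i , i<n , rest , i≤min) = leads-or-below B (suc-injective len) sub nonempty ¬leads
              in  suc i , s<s i<n , rest , s≤s i≤min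

emptyᵇ≡size≡ᵇ0 : (n : ℕ) (U : ℕ → Bool) → emptyᵇ n U ≡ (size n U ≡ᵇ 0)
emptyᵇ≡size≡ᵇ0 zero    U = refl
emptyᵇ≡size≡ᵇ0 (suc n) U with U 0
... | true  = refl
... | false = emptyᵇ≡size≡ᵇ0 n (U ∘ suc)

size-∖ : (n : ℕ) (B : List Bool) {U : ℕ → Bool} → length B ≡ n → T (B ⊆ᵇ[ n ] U) → size n (U ∖ B) + card B ≡ size n U
size-∖ zero    []          _   _   = refl
size-∖ (suc n) (true ∷ B)  {U} len sub with U 0
... | true  = trans (+-suc _ (card B)) (cong suc (size-∖ n B (suc-injective len) sub))
size-∖ (suc n) (false ∷ B) {U} len sub =
  trans (+-assoc (χ (U 0 ∧ true)) _ _) (cong₂ _+_ (cong χ (∧-identityʳ (U 0))) (size-∖ n B (suc-injective len) sub))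

firstBlock-above : (n : ℕ) {U : ℕ → Bool} {b : ℕ} → (∀ {i} → i < n → T (U i) → b ≤ i) →
                   (B : List Bool) → length B ≡ n → firstBlockᵇ n U b B ≡ smallBlockᵇ B ∧ (B ⊆ᵇ[ n ] U)
firstBlock-above n {U} {b} above B len = T-ext to from
  where
  to : T (firstBlockᵇ n U b B) → T (smallBlockᵇ B ∧ (B ⊆ᵇ[ n ] U))
  to fb = let (small , _ , sub) = firstBlock-parts n {U} {b} B fb in T-∧⁺ small sub
  from : T (smallBlockᵇ B ∧ (B ⊆ᵇ[ n ] U)) → T (firstBlockᵇ n U b B)
  from h = let (small , sub) = T-∧⁻ h
               min∈B = minElem-mem B (≤ᵇ⇒≤ 1 (card B) (proj₁ (T-∧⁻ small)))
               min<n = subst (minElem B <_) len (memᵇ-< B min∈B)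
           in  T-∧⁺ small (T-∧⁺ (≤⇒≤ᵇ (above min<n (⊆ᵇ-mem n B sub min<n min∈B))) sub)

∑-subsetsBelow1 : (n : ℕ) (V : ℕ → Bool) (g : ℕ → ℕ) →
  ∑[ B ∈ allSubsets n ] (χ ((card B <ᵇ 1) ∧ (B ⊆ᵇ[ n ] V)) * g (card B)) ≡ g 0
∑-subsetsBelow1 zero    V g = trans (+-identityʳ _) (*-identityˡ (g 0))
∑-subsetsBelow1 (suc n) V g = begin
  ∑[ B ∈ allSubsets (suc n) ] (χ ((card B <ᵇ 1) ∧ (B ⊆ᵇ[ suc n ] V)) * g (card B))
    ≡⟨ ∑-tuplesOver-suc (false ∷ true ∷ []) n _ ⟩
  ∑[ B ∈ allSubsets n ] (χ ((card B <ᵇ 1) ∧ (B ⊆ᵇ[ n ] (V ∘ suc))) * g (card B)) + (∑[ B ∈ allSubsets n ] 0 + 0)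
    ≡⟨ cong₂ (λ x y → x + (y + 0)) (∑-subsetsBelow1 n (V ∘ suc) g) (∑-zero (allSubsets n)) ⟩
  g 0 + 0
    ≡⟨ +-identityʳ (g 0) ⟩
  g 0
    ∎

∑-subsetsBelow2 : (n : ℕ) (V : ℕ → Bool) (g : ℕ → ℕ) →
  ∑[ B ∈ allSubsets n ] (χ ((card B <ᵇ 2) ∧ (B ⊆ᵇ[ n ] V)) * g (card B)) ≡ g 0 + size n V * g 1
∑-subsetsBelow2 zero    V g = trans (+-identityʳ _) (trans (*-identityˡ (g 0)) (sym (+-identityʳ (g 0))))
∑-subsetsBelow2 (suc n) V g = begin
  ∑[ B ∈ allSubsets (suc n) ] (χ ((card B <ᵇ 2) ∧ (B ⊆ᵇ[ suc n ] V)) * g (card B))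
    ≡⟨ ∑-tuplesOver-suc (false ∷ true ∷ []) n _ ⟩
  ∑[ B ∈ allSubsets n ] (χ ((card B <ᵇ 2) ∧ (B ⊆ᵇ[ n ] V′)) * g (card B)) + (withFirst (V 0) + 0)
    ≡⟨ cong₂ (λ x y → x + (y + 0)) (∑-subsetsBelow2 n V′ g) (withFirst≡ (V 0)) ⟩
  g 0 + size n V′ * g 1 + (χ (V 0) * g 1 + 0)
    ≡⟨ rearrange (g 0) (size n V′) (g 1) (χ (V 0)) ⟩
  g 0 + size (suc n) V * g 1
    ∎
  where
  V′ : ℕ → Bool
  V′ = V ∘ suc
  withFirst : Bool → ℕ
  withFirst v = ∑[ B ∈ allSubsets n ] (χ ((card B <ᵇ 1) ∧ (v ∧ (B ⊆ᵇ[ n ] V′))) * g (suc (card B)))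
  withFirst≡ : ∀ v → withFirst v ≡ χ v * g 1
  withFirst≡ true  = trans (∑-subsetsBelow1 n V′ (g ∘ suc)) (sym (+-identityʳ (g 1)))
  withFirst≡ false = trans (∑-cong (allSubsets n) λ B → cong (λ e → χ e * g (suc (card B))) (∧-zeroʳ (card B <ᵇ 1)))
                           (∑-zero (allSubsets n))
  rearrange : ∀ a s b v → a + s * b + (v * b + 0) ≡ a + (v + s) * b
  rearrange = solve-∀

-- the block of the least element of a c-element set: alone, or with one of the c - 1 others
leadBlockSum : ℕ → (ℕ → ℕ) → ℕ
leadBlockSum zero    h = 0
leadBlockSum (suc c) h = h 1 + c * h 2

∑-leadBlocks : (n : ℕ) (U : ℕ → Bool) (h : ℕ → ℕ) →
  ∑[ B ∈ allSubsets n ] (χ (smallBlockᵇ B ∧ ((B ⊆ᵇ[ n ] U) ∧ leadsᵇ U B)) * h (card B)) ≡ leadBlockSum (size n U) h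
∑-leadBlocks zero    U h = refl
∑-leadBlocks (suc n) U h =
  trans (∑-tuplesOver-suc (false ∷ true ∷ []) n _) (split (U 0))
  where
  U′ : ℕ → Bool
  U′ = U ∘ suc
  split : ∀ u →
    ∑[ B ∈ allSubsets n ] (χ (smallBlockᵇ B ∧ ((B ⊆ᵇ[ n ] U′) ∧ (if u then false else leadsᵇ U′ B))) * h (card B)) +
    (∑[ B ∈ allSubsets n ] (χ ((card B <ᵇ 2) ∧ ((u ∧ (B ⊆ᵇ[ n ] U′)) ∧ (if u then true else leadsᵇ U′ B))) * h (suc (card B))) + 0)
    ≡ leadBlockSum (χ u + size n U′) h
  split true = trans
    (cong₂ (λ x y → x + (y + 0))
      (trans (∑-cong (allSubsets n) λ B → cong (λ e → χ e * h (card B))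
                                                (trans (cong (smallBlockᵇ B ∧_) (∧-zeroʳ _)) (∧-zeroʳ _)))
             (∑-zero (allSubsets n)))
      (trans (∑-cong (allSubsets n) λ B → cong (λ e → χ ((card B <ᵇ 2) ∧ e) * h (suc (card B))) (∧-identityʳ _))
             (∑-subsetsBelow2 n U′ (h ∘ suc))))
    (+-identityʳ (h 1 + size n U′ * h 2))
  split false = trans
    (cong₂ (λ x y → x + (y + 0))
      (∑-leadBlocks n U′ h)
      (trans (∑-cong (allSubsets n) λ B → cong (λ e → χ e * h (suc (card B))) (∧-zeroʳ (card B <ᵇ 2)))
             (∑-zero (allSubsets n))))
    (+-identityʳ (leadBlockSum (size n U′) h))

leadBlockSum-tilings : (c j : ℕ) → leadBlockSum c (λ d → tilings suc (c ∸ d) j) ≡ tilings suc c (suc j)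
leadBlockSum-tilings zero          j = refl
leadBlockSum-tilings (suc zero)    j = refl
leadBlockSum-tilings (suc (suc c)) j = refl

allSubsets-length : (n : ℕ) → All (λ B → All (λ _ → ⊤) B × length B ≡ n) (allSubsets n)
allSubsets-length n = tuplesOver-All (tt ∷ tt ∷ []) n

partitionCount-above : (n : ℕ) {U : ℕ → Bool} {b : ℕ} → (∀ {i} → i < n → T (U i) → b ≤ i) →
                       ∀ j → partitionCount n U b j ≡ tilings suc (size n U) j
partitionCount-above n {U} {b} above zero = begin
  partitionCount n U b 0      ≡⟨ count≡∑χ (partitionsᵇ n U b) ([] ∷ []) ⟩
  χ (emptyᵇ n U) + 0          ≡⟨ +-identityʳ _ ⟩
  χ (emptyᵇ n U)              ≡⟨ cong χ (emptyᵇ≡size≡ᵇ0 n U) ⟩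
  χ (size n U ≡ᵇ 0)           ≡⟨ tilings-zero (size n U) ⟩
  tilings suc (size n U) 0    ∎
  where
  tilings-zero : ∀ c → χ (c ≡ᵇ 0) ≡ tilings suc c 0
  tilings-zero zero    = refl
  tilings-zero (suc c) = refl
partitionCount-above n {U} {b} above (suc j) = begin
  partitionCount n U b (suc j)
    ≡⟨ partitionCount-suc n U b j ⟩
  ∑[ B ∈ allSubsets n ] (χ (firstBlockᵇ n U b B) * partitionCount n (U ∖ B) (suc (minElem B)) j)
    ≡⟨ ∑-cong-All (λ {B} (_ , len) → first-block B len) (allSubsets-length n) ⟩
  ∑[ B ∈ allSubsets n ] (χ (smallBlockᵇ B ∧ ((B ⊆ᵇ[ n ] U) ∧ leadsᵇ U B)) * h (card B))
    ≡⟨ ∑-leadBlocks n U h ⟩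
  leadBlockSum (size n U) h
    ≡⟨ leadBlockSum-tilings (size n U) j ⟩
  tilings suc (size n U) (suc j)
    ∎
  where
  h : ℕ → ℕ
  h c = tilings suc (size n U ∸ c) j
  first-block : ∀ B → length B ≡ n →
    χ (firstBlockᵇ n U b B) * partitionCount n (U ∖ B) (suc (minElem B)) j ≡
    χ (smallBlockᵇ B ∧ ((B ⊆ᵇ[ n ] U) ∧ leadsᵇ U B)) * h (card B)
  first-block B len rewrite firstBlock-above n above B len with smallBlockᵇ B in small | B ⊆ᵇ[ n ] U in sub
  ... | false | _    = refl
  ... | true  | false = refl
  ... | true  | true with leadsᵇ U B in leads
  ...   | true  = cong (_+ 0) (trans (partitionCount-above n above′ j) (cong (λ s → tilings suc s j) size-eq))
    where
    above′ : ∀ {i} → i < n → T ((U ∖ B) i) → suc (minElem B) ≤ i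
    above′ = leads-above B len (subst T (sym sub) tt) (subst T (sym leads) tt)
    size-eq : size n (U ∖ B) ≡ size n U ∸ card B
    size-eq = trans (sym (m+n∸n≡m _ (card B))) (cong (_∸ card B) (size-∖ n B len (subst T (sym sub) tt)))
  ...   | false =
    let nonempty = ≤ᵇ⇒≤ 1 (card B) (proj₁ (T-∧⁻ (subst T (sym small) tt)))
        (i , i<n , left , i≤min) = leads-or-below B len (subst T (sym sub) tt) nonempty (subst T leads)
    in  cong (_+ 0) (partitionCount-low n i<n left (s≤s i≤min) j)

size-full : (n : ℕ) → size n (λ _ → true) ≡ n
size-full zero    = refl
size-full (suc n) = cong suc (size-full n)

S≤2≡tilings : (n k : ℕ) → S≤2 n k ≡ tilings suc n k
S≤2≡tilings n k = begin
  S≤2 n k                                  ≡⟨ S≤2≡partitionCount n k ⟩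
  partitionCount n (λ _ → true) 0 k        ≡⟨ partitionCount-above n (λ _ _ → z≤n) k ⟩
  tilings suc (size n (λ _ → true)) k      ≡⟨ cong (λ s → tilings suc s k) (size-full n) ⟩
  tilings suc n k                          ∎

fUFR≡k!*S≤2-vanishing : (n k : ℕ) → (∀ w → tilings w n k ≡ 0) → fUFR n k ≡ k ! * S≤2 n k
fUFR≡k!*S≤2-vanishing n k vanish = begin
  fUFR n k       ≡⟨ m*n≡0⇒m≡0 (fUFR n k) (2 ^ (n ∸ k)) {{m^n≢0 2 (n ∸ k)}} no-rankings ⟩
  0              ≡⟨ *-zeroʳ (k !) ⟨
  k ! * 0        ≡⟨ cong (k ! *_) (trans (S≤2≡tilings n k) (vanish suc)) ⟨
  k ! * S≤2 n k  ∎
  where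
  no-rankings : fUFR n k * 2 ^ (n ∸ k) ≡ 0
  no-rankings = trans (fUFR-closed n k) (cong (_* n !) (trans (length-shapes n k) (vanish (λ _ → 1))))

fUFR≡k!*S≤2-blocks : (a b : ℕ) → fUFR (a + (b + b)) (a + b) ≡ (a + b) ! * S≤2 (a + (b + b)) (a + b)
fUFR≡k!*S≤2-blocks a b = *-cancelʳ-≡ _ _ X {{X≢0}} (begin
  fUFR n k * X
    ≡⟨ *-assoc (fUFR n k) (2 ^ b) (a ! * b !) ⟨
  fUFR n k * 2 ^ b * (a ! * b !)
    ≡⟨ cong (λ e → fUFR n k * 2 ^ e * (a ! * b !)) n∸k≡b ⟨
  fUFR n k * 2 ^ (n ∸ k) * (a ! * b !)
    ≡⟨ cong (_* (a ! * b !)) (fUFR-closed n k) ⟩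
  length (shapes n k) * n ! * (a ! * b !)
    ≡⟨ xy∙z≈xz∙y (length (shapes n k)) (n !) (a ! * b !) ⟩
  length (shapes n k) * (a ! * b !) * n !
    ≡⟨ cong (λ l → l * (a ! * b !) * n !) (length-shapes n k) ⟩
  tilings (λ _ → 1) n k * (a ! * b !) * n !
    ≡⟨ cong (_* n !) (binomial-tilings a b) ⟩
  k ! * n !
    ≡⟨ cong (k ! *_) (pairing-tilings a b) ⟨
  k ! * (tilings suc n k * X)
    ≡⟨ cong (λ s → k ! * (s * X)) (S≤2≡tilings n k) ⟨
  k ! * (S≤2 n k * X)
    ≡⟨ *-assoc (k !) (S≤2 n k) X ⟨
  k ! * S≤2 n k * X
    ∎)
  where
  n k X : ℕ
  n = a + (b + b)
  k = a + b
  X = 2 ^ b * (a ! * b !)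
  X≢0 : NonZero X
  X≢0 = m*n≢0 (2 ^ b) (a ! * b !) {{m^n≢0 2 b}} {{a !* b !≢0}}
  n∸k≡b : n ∸ k ≡ b
  n∸k≡b = trans ([m+n]∸[m+o]≡n∸o a (b + b) b) (m+n∸n≡m b b)

blockCounts : {n k : ℕ} → k ≤ n → n ≤ k + k → ∃[ a ] ∃[ b ] n ≡ a + (b + b) × k ≡ a + b
blockCounts {n} {k} k≤n n≤2k = k ∸ b , b , n≡a+2b , k≡a+b
  where
  b : ℕ
  b = n ∸ k
  k+b≡n : k + b ≡ n
  k+b≡n = m+[n∸m]≡n k≤n
  k≡a+b : k ≡ (k ∸ b) + b
  k≡a+b = sym (m∸n+n≡m (+-cancelˡ-≤ k b k (subst (_≤ k + k) (sym k+b≡n) n≤2k)))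
  n≡a+2b : n ≡ (k ∸ b) + (b + b)
  n≡a+2b = trans (sym k+b≡n) (trans (cong (_+ b) k≡a+b) (+-assoc (k ∸ b) b b))

corollary3p6 : (n k : ℕ) → 1 ≤ n → fUFR n k ≡ (k !) * S≤2 n k
corollary3p6 n k _ with k ≤? n | n ≤? k + k
... | no k≰n | _        = fUFR≡k!*S≤2-vanishing n k (λ w → tilings-vanish-< w n k (≰⇒> k≰n))
... | yes _  | no n≰2k  = fUFR≡k!*S≤2-vanishing n k (λ w → tilings-vanish-> w n k (≰⇒> n≰2k))
... | yes k≤n | yes n≤2k with blockCounts k≤n n≤2k
...   | a , b , refl , refl = fUFR≡k!*S≤2-blocks a b
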